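{- Let $\mathcal{S}$ be a schema and let $\Sigma=\langle\Gamma_O,\Gamma_V,\Delta\rangle$ be an ER specification over $\mathcal{S}$. Let $\mathcal{S}_{\mathsf{V}}$ be the schema obtained from $\mathcal{S}$ by changing every object position into a value position, and for an $\mathcal{S}$-database $D$ let $D^{\mathsf{V}}$ denote the same set of facts viewed as an $\mathcal{S}_{\mathsf{V}}$-database (all object constants of $D$ are treated as value constants; in particular $\mathsf{Obj}(D^{\mathsf{V}})=\emptyset$ and $\mathsf{Cells}(D^{\mathsf{V}})$ contains all positions $\langle t,i\rangle$ with $i\ge 1$). Then there exists an ER specification $\Sigma'=\langle\emptyset,\Gamma_V',\Delta\rangle$ over $\mathcal{S}_{\mathsf{V}}$ (having no rules for objects and the same denial constraints $\Delta$) such that for every $\mathcal{S}$-database $D$: $$\mathsf{Sol}(D^{\mathsf{V}},\Sigma')=\{\langle\emptyset,\,V\cup V_E\rangle \mid \langle E,V\rangle\in\mathsf{Sol}(D,\Sigma)\},$$ where $V_E$ is the set of all pairs $(\langle t,i\rangle,\langle t',j\rangle)$ of positions of $D$ such that $(t[i],t'[j])\in E$.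
   Context: Constants come from three pairwise disjoint infinite sets: objects $\mathsf{O}$, values $\mathsf{V}$, and tuple identifiers (tids) $\mathsf{TID}$. A schema $\mathcal{S}$ is a finite set of relation symbols $R$, each with an arity $k$ and a type vector in $\{\mathsf{O},\mathsf{V}\}^k$; position $i$ of $R$ is an object (resp. value) position if $\mathbf{type}(R,i)=\mathsf{O}$ (resp. $\mathsf{V}$). An $\mathcal{S}$-database $D$ is a finite set of facts $R(t,c_1,\dots,c_k)$ with $R/k\in\mathcal{S}$, $t\in\mathsf{TID}$, $c_i\in\mathbf{type}(R,i)$, each tid occurring in at most one fact; $t[i]$ is the constant at position $i$ of the fact with tid $t$. $\mathsf{Obj}(D)$ is the set of objects occurring in $D$, $\mathsf{Dom}(D)$ the set of constants occurring in $D$, and $\mathsf{Cells}(D)=\{\langle t,i\rangle\mid R(t,c_1,\dots,c_k)\in D,\ \mathbf{type}(R,i)=\mathsf{V}\}$. A conjunctive query (CQ) $q(\vec x)=\exists\vec y.\varphi(\vec x,\vec y)$ has $\varphi$ a conjunction of relational atoms $R(u_0,u_1,\dots,u_k)$ ($u_0$ in the tid position, terms are constants or variables); extended CQs may also contain inequality atoms $z\neq z'$ and atoms $u\approx u'$ of binary similarity predicates with a fixed interpretation over constants (these never use the tid position). A denial constraint has the form $\exists\vec y.\varphi(\vec y)\to\bot$ with $\varphi$ a Boolean CQ possibly with inequalities, every variable of an inequality occurring in a relational atom. $\mathsf{EqRel}(P,S)$ is the smallest equivalence relation on $S$ containing $P$. Induced database: for an equivalence relation $E$ on $\mathsf{Obj}(D)$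 and $V$ on $\mathsf{Cells}(D)$, $D_{E,V}$ is obtained from $D$ by replacing each tid $t$ by $\{t\}$, each occurrence of an object $o$ by $\{o'\mid(o,o')\in E\}$, and the value in each cell $\langle t,i\rangle$ by $\{t'[i']\mid(\langle t,i\rangle,\langle t',i'\rangle)\in V\}$. A Boolean (extended) query $q$ is satisfied in $D_{E,V}$ if there are $h:\mathrm{vars}(q)\cup\mathrm{cons}(q)\to 2^{\mathsf{Dom}(D)}\setminus\{\emptyset\}$ and, for each $k$-ary relational atom $\pi$ of $q$, $g_\pi:\{0,\dots,k\}\to 2^{\mathsf{Dom}(D)}$ such that: (1) $h(a)=\{a\}$ for constants $a$, and for each variable $z$, $h(z)$ is the intersection of all $g_\pi(i)$ with $z$ the $i$-th argument of $\pi$; (2) for each relational atom $\pi=R(u_0,\dots,u_k)$, $R(g_\pi(0),\dots,g_\pi(k))\in D_{E,V}$, and $u_i\in g_\pi(i)$ whenever $u_i$ is a constant; (3) for each $z\neq z'$, $h(z)\cap h(z')=\emptyset$; (4) for each $u\approx u'$, some $c\in h(u)$, $c'\in h(u')$ satisfy $c\approx c'$. The answers $q(D_{E,V})$ of $q(\vec x)$ are the tuples $\vec c$ with $D_{E,V}\models q[\vec c]$. Rules: a hard (resp. soft) rule for objects is $q(x,y)\Rightarrow\mathsf{EqO}(x,y)$ (resp. $q(x,y)\dashrightarrow\mathsf{EqO}(x,y)$), $q$ a CQ possibly with similarity atoms, $x,y$ occurring only in object positions. A hard (resp. soft) rule for values is $q(x_t,y_t)\Rightarrow\mathsf{EqV}(\langle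 x_t,i\rangle,\langle y_t,j\rangle)$ (resp. with $\dashrightarrow$), $q$ a CQ possibly with similarity atoms, $x_t,y_t$ each occurring once in $q$, in position 0 of relational atoms over $R_x,R_y$, with $i,j$ value positions of $R_x,R_y$. An ER specification is $\Sigma=\langle\Gamma_O,\Gamma_V,\Delta\rangle$ with $\Gamma_O=\Gamma^o_h\cup\Gamma^o_s$ a finite set of hard and soft rules for objects, $\Gamma_V=\Gamma^v_h\cup\Gamma^v_s$ a finite set of hard and soft rules for values, $\Delta$ a finite set of denial constraints. $D_{E,V}$ satisfies a denial constraint iff it does not satisfy its body; it satisfies an object rule iff $q(D_{E,V})\subseteq E$; it satisfies a value rule iff $(t_1,t_2)\in q(D_{E,V})$ implies $(\langle t_1,i\rangle,\langle t_2,j\rangle)\in V$. Candidate solutions for $(D,\Sigma)$ are defined inductively: $\langle\mathsf{EqRel}(\emptyset,\mathsf{Obj}(D)),\mathsf{EqRel}(\emptyset,\mathsf{Cells}(D))\rangle$ is one; if $\langle E',V\rangle$ is one and $(o,o')\in q(D_{E',V})$ for some rule $q(x,y)\to\mathsf{EqO}(x,y)\in\Gamma_O$ (hard or soft), then $\langle\mathsf{EqRel}(E'\cup\{(o,o')\},\mathsf{Obj}(D)),V\rangle$ is one; if $\langle E,V'\rangle$ is one and $(t,t')\in q(D_{E,V'})$ for some rule $q(x_t,y_t)\to\mathsf{EqV}(\langle x_t,i\rangle,\langle y_t,i'\rangle)\in\Gamma_V$, then $\langle E,\mathsf{EqRel}(V'\cup\{(\langle t,i\rangle,\langle t',i'\rangle)\},\mathsf{Cells}(D))\rangle$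 is one. A solution is a candidate solution $\langle E,V\rangle$ with $D_{E,V}$ satisfying $\Gamma^o_h\cup\Gamma^v_h\cup\Delta$; $\mathsf{Sol}(D,\Sigma)$ is the set of solutions. -}

module Defs where

open import Level using (Level)
open import Data.Nat using (ℕ; zero; suc; _≟_)
open import Data.Fin using (Fin; toℕ)
open import Data.Vec using (Vec; lookup)
import Data.Vec as Vec
open import Data.List using (List; [])
import Data.List as List
open import Data.List.Membership.Propositional using (_∈_)
open import Data.List.Relation.Unary.All using (All)
open import Data.Product using (Σ; ∃; ∃-syntax; _×_; _,_)
open import Data.Sum using (_⊎_)
open import Data.Bool using (Bool; true; false; if_then_else_)
open import Data.Empty using (⊥)
open import Relation.Nullary using (¬_)
open import Relation.Nullary.Decidable using (⌊_⌋)
open import Relation.Binary.PropositionalEquality using (_≡_)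

_iff_ : ∀ {a b : Level} → Set a → Set b → Set _
A iff B = (A → B) × (B → A)

Rel₀ : Set → Set₁
Rel₀ A = A → A → Set

_≐_ : ∀ {A : Set} → Rel₀ A → Rel₀ A → Set
P ≐ Q = ∀ a b → P a b iff Q a b

_∪₂_ : ∀ {A : Set} → Rel₀ A → Rel₀ A → Rel₀ A
(P ∪₂ Q) a b = P a b ⊎ Q a b

single : ∀ {A : Set} → A → A → Rel₀ A
single x y a b = (a ≡ x) × (b ≡ y)

emptyRel : ∀ {A : Set} → Rel₀ A
emptyRel _ _ = ⊥

data EqRel {A : Set} (P : Rel₀ A) (S : A → Set) : A → A → Set where
  incl  : ∀ {a b} → S a → S b → P a b → EqRel P S a b
  refl' : ∀ {a} → S a → EqRel P S a a
  sym'  : ∀ {a b} → EqRel P S a b → EqRel P S b a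
  trans' : ∀ {a b c} → EqRel P S a b → EqRel P S b c → EqRel P S a c

data Const : Set where
  obj  : ℕ → Const
  val  : ℕ → Const
  tidc : ℕ → Const

data Ty : Set where
  tyO tyV : Ty

-- Positions of a k-ary relation are 0 (tid) and 1..k ; the argument
-- position p ∈ {1..k} corresponds to j : Fin k with p = suc (toℕ j).

record Signature : Set where
  field
    nrel  : ℕ
    arity : Fin nrel → ℕ
open Signature public

record Schema : Set where
  field
    sig  : Signature
    type : (R : Fin (nrel sig)) → Fin (arity sig R) → Ty
open Schema public

valSchema : Schema → Schema
valSchema S = record { sig = sig S ; type = λ _ _ → tyV }

record Fact (Sg : Signature) : Set where
  constructor fact
  field
    rel   : Fin (nrel Sg)
    tidOf : ℕ
    args  : Vec Const (arity Sg rel)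
open Fact public

Database : Signature → Set
Database Sg = List (Fact Sg)

HasTy : Ty → Const → Set
HasTy tyO c = ∃[ n ] (c ≡ obj n)
HasTy tyV c = ∃[ n ] (c ≡ val n)

WellTyped : (S : Schema) → Database (sig S) → Set
WellTyped S D = ∀ f → f ∈ D → ∀ j → HasTy (type S (rel f) j) (lookup (args f) j)

UniqueTids : ∀ {Sg} → Database Sg → Set
UniqueTids D = ∀ f f' → f ∈ D → f' ∈ D → tidOf f ≡ tidOf f' → f ≡ f'

Cell : Set
Cell = ℕ × ℕ   -- ⟨ t , i ⟩ with t a tid and i ≥ 1 a position

ValAt : ∀ {Sg} → Database Sg → ℕ → ℕ → Const → Set
ValAt D t i c = ∃[ f ] (f ∈ D × tidOf f ≡ t ×
                  ∃[ j ] (suc (toℕ j) ≡ i × lookup (args f) j ≡ c))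

Obj : (S : Schema) → Database (sig S) → Const → Set
Obj S D c = ∃[ f ] (f ∈ D × ∃[ j ] (type S (rel f) j ≡ tyO × lookup (args f) j ≡ c))

Cells : (S : Schema) → Database (sig S) → Cell → Set
Cells S D (t , i) = ∃[ f ] (f ∈ D × tidOf f ≡ t ×
                      ∃[ j ] (suc (toℕ j) ≡ i × type S (rel f) j ≡ tyV))

Dom : ∀ {Sg} → Database Sg → Const → Set
Dom D c = ∃[ f ] (f ∈ D × (c ≡ tidc (tidOf f) ⊎ ∃[ j ] (lookup (args f) j ≡ c)))

VE : ∀ {Sg} → Database Sg → Rel₀ Const → Rel₀ Cell
VE D E (t , i) (t' , j) = ∃[ a ] ∃[ b ] (ValAt D t i a × ValAt D t' j b × E a b)

-- the set replacing the constant at position j of fact f in D_{E,V}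
cellSetTy : ∀ {Sg} → Ty → Database Sg → Rel₀ Const → Rel₀ Cell →
            (f : Fact Sg) → Fin (arity Sg (rel f)) → Const → Set
cellSetTy tyO D E V f j c = E (lookup (args f) j) c
cellSetTy tyV D E V f j c =
  ∃[ t' ] ∃[ i' ] (V (tidOf f , suc (toℕ j)) (t' , i') × ValAt D t' i' c)

cellSet : (S : Schema) → Database (sig S) → Rel₀ Const → Rel₀ Cell →
          (f : Fact (sig S)) → Fin (arity (sig S) (rel f)) → Const → Set
cellSet S D E V f j = cellSetTy (type S (rel f) j) D E V f j

ObjPos : (S : Schema) → Fin (nrel (sig S)) → ℕ → Set
ObjPos S R p = ∃[ j ] (suc (toℕ j) ≡ p × type S R j ≡ tyO)

ValPos : (S : Schema) → Fin (nrel (sig S)) → ℕ → Set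
ValPos S R p = ∃[ j ] (suc (toℕ j) ≡ p × type S R j ≡ tyV)

data Term : Set where
  var : ℕ → Term
  con : Const → Term

module ER (Sim : Set) (⟦_⟧ : Sim → Const → Const → Set) where

  record RAtom (Sg : Signature) : Set where
    constructor ratom
    field
      arel  : Fin (nrel Sg)
      u0    : Term
      aargs : Vec Term (arity Sg arel)
  open RAtom public

  record Query (Sg : Signature) : Set where
    field
      nr    : ℕ
      atoms : Fin nr → RAtom Sg
      neq   : List (Term × Term)
      sim   : List (Sim × Term × Term)
  open Query public

  -- term at position p (0 = tid position) of relational atom a is u
  TermAt : ∀ {Sg} → (q : Query Sg) → Fin (nr q) → ℕ → Term → Set
  TermAt q a zero u = u0 (atoms q a) ≡ u
  TermAt q a (suc p) u = ∃[ j ] (toℕ j ≡ p × lookup (aargs (atoms q a)) j ≡ u)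

  InRel : ∀ {Sg} → Query Sg → Term → Set
  InRel q u = ∃[ a ] ∃[ p ] TermAt q a p u

  InNeq : ∀ {Sg} → Query Sg → Term → Set
  InNeq q u = ∃[ u' ] ((u , u') ∈ neq q ⊎ (u' , u) ∈ neq q)

  InSim : ∀ {Sg} → Query Sg → Term → Set
  InSim q u = ∃[ s ] ∃[ u' ] ((s , u , u') ∈ sim q ⊎ (s , u' , u) ∈ sim q)

  OccursQ : ∀ {Sg} → Query Sg → Term → Set
  OccursQ q u = InRel q u ⊎ InNeq q u ⊎ InSim q u

  substT : ℕ → Const → Term → Term
  substT x c (var z) = if ⌊ z ≟ x ⌋ then con c else var z
  substT x c (con a) = con a

  substQ : ∀ {Sg} → ℕ → Const → Query Sg → Query Sg
  substQ x c q = record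
    { nr = nr q
    ; atoms = λ a → ratom (arel (atoms q a)) (substT x c (u0 (atoms q a)))
                          (Vec.map (substT x c) (aargs (atoms q a)))
    ; neq = List.map (λ { (u , u') → substT x c u , substT x c u' }) (neq q)
    ; sim = List.map (λ { (s , u , u') → s , substT x c u , substT x c u' }) (sim q)
    }

  Sat : (S : Schema) → Database (sig S) → Rel₀ Const → Rel₀ Cell →
        Query (sig S) → Set₁
  Sat S D E V q =
    ∃[ g ] (
      (∀ a → ∃[ f ] (f ∈ D × rel f ≡ arel (atoms q a)
                    × (∀ c → g a 0 c iff (c ≡ tidc (tidOf f)))
                    × (∀ j c → g a (suc (toℕ j)) c iff cellSet S D E V f j c)))
      × (∀ a p c → TermAt q a p (con c) → g a p c)
      × (∀ z → OccursQ q (var z) → ∃[ c ] h g (var z) c)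
      × (∀ c → OccursQ q (con c) → Dom D c)
      × (∀ u u' → (u , u') ∈ neq q → ∀ c → h g u c → h g u' c → ⊥)
      × (∀ s u u' → (s , u , u') ∈ sim q →
           ∃[ c ] ∃[ c' ] (h g u c × h g u' c' × ⟦ s ⟧ c c')))
    where
      h : (Fin (nr q) → ℕ → Const → Set) → Term → Const → Set
      h g (var z) c = Dom D c × (∀ a p → TermAt q a p (var z) → g a p c)
      h g (con a) c = c ≡ a

  Ans : (S : Schema) → Database (sig S) → Rel₀ Const → Rel₀ Cell →
        Query (sig S) → ℕ → ℕ → Const → Const → Set₁
  Ans S D E V q x y c c' = ((x ≡ y → c ≡ c') × Sat S D E V (substQ y c' (substQ x c q)))

  -- rules for objects  q(x,y) ⇒/⇢ EqO(x,y)   (hard = true for ⇒)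
  record ORule (Sg : Signature) : Set where
    field
      ohard : Bool
      obody : Query Sg
      ox oy : ℕ
  open ORule public

  -- rules for values  q(x_t,y_t) ⇒/⇢ EqV(⟨x_t,i⟩,⟨y_t,j⟩)
  record VRule (Sg : Signature) : Set where
    field
      vhard : Bool
      vbody : Query Sg
      vx vy : ℕ
      vi vj : ℕ
  open VRule public

  record Spec (Sg : Signature) : Set where
    field
      ΓO : List (ORule Sg)
      ΓV : List (VRule Sg)
      Δ  : List (Query Sg)
  open Spec public

  WFORule : (S : Schema) → ORule (sig S) → Set
  WFORule S r = neq (obody r) ≡ [] × onlyObj (ox r) × onlyObj (oy r)
    where
      onlyObj : ℕ → Set
      onlyObj x = InRel (obody r) (var x)
                × (∀ a p → TermAt (obody r) a p (var x) → ObjPos S (arel (atoms (obody r) a)) p)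
                × ¬ InSim (obody r) (var x)

  WFVRule : (S : Schema) → VRule (sig S) → Set
  WFVRule S r = neq (vbody r) ≡ [] × once (vx r) (vi r) × once (vy r) (vj r)
    where
      once : ℕ → ℕ → Set
      once x i = ∃[ a ] (u0 (atoms (vbody r) a) ≡ var x
                   × ValPos S (arel (atoms (vbody r) a)) i
                   × (∀ b p → TermAt (vbody r) b p (var x) → (b ≡ a × p ≡ 0))
                   × ¬ InSim (vbody r) (var x))

  WFDenial : (S : Schema) → Query (sig S) → Set
  WFDenial S q = sim q ≡ []
    × (∀ u u' → (u , u') ∈ neq q → ∀ z → (u ≡ var z ⊎ u' ≡ var z) → InRel q (var z))

  WFSpec : (S : Schema) → Spec (sig S) → Set
  WFSpec S Sp = All (WFORule S) (ΓO Sp) × All (WFVRule S) (ΓV Sp) × All (WFDenial S) (Δ Sp)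

  SatHard : (S : Schema) → Database (sig S) → Spec (sig S) →
            Rel₀ Const → Rel₀ Cell → Set₁
  SatHard S D Sp E V =
      (∀ r → r ∈ ΓO Sp → ohard r ≡ true →
         ∀ c c' → Ans S D E V (obody r) (ox r) (oy r) c c' → E c c')
    × (∀ r → r ∈ ΓV Sp → vhard r ≡ true →
         ∀ t t' → Ans S D E V (vbody r) (vx r) (vy r) (tidc t) (tidc t') →
         V (t , vi r) (t' , vj r))
    × (∀ δ → δ ∈ Δ Sp → ¬ Sat S D E V δ)

  data Cand (S : Schema) (D : Database (sig S)) (Sp : Spec (sig S)) :
            Rel₀ Const → Rel₀ Cell → Set₁ where
    init  : Cand S D Sp (EqRel emptyRel (Obj S D)) (EqRel emptyRel (Cells S D))
    stepO : ∀ {E V} → Cand S D Sp E V → ∀ r → r ∈ ΓO Sp → ∀ c c' →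
            Ans S D E V (obody r) (ox r) (oy r) c c' →
            Cand S D Sp (EqRel (E ∪₂ single c c') (Obj S D)) V
    stepV : ∀ {E V} → Cand S D Sp E V → ∀ r → r ∈ ΓV Sp → ∀ t t' →
            Ans S D E V (vbody r) (vx r) (vy r) (tidc t) (tidc t') →
            Cand S D Sp E (EqRel (V ∪₂ single (t , vi r) (t' , vj r)) (Cells S D))

  -- ⟨E , V⟩ ∈ Sol(D , Σ)   (relations compared extensionally)
  IsSol : (S : Schema) → Database (sig S) → Spec (sig S) →
          Rel₀ Const → Rel₀ Cell → Set₁
  IsSol S D Sp E V =
    ∃[ E₀ ] ∃[ V₀ ] (Cand S D Sp E₀ V₀ × E₀ ≐ E × V₀ ≐ V × SatHard S D Sp E V)

{-# OPTIONS --safe #-}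
-- Objects can be simulated by value cells. Σ′ keeps the value rules and the denial constraints,
-- turns each object rule q(x , y) ⇒ EqO(x , y) into a value rule merging the cells that hold x and y
-- (their tuples are reached through copies of the atoms of x and y with fresh tid variables), and adds
-- hard rules merging any two cells that hold the same object. For every ⟨E , V⟩, the databases D_{E,V}
-- and (D^V)_{∅ , V ∪ V_E} replace each position by the same set of constants, so both specifications
-- have the same query answers. Candidates then simulate each other step by step: forwards, after
-- saturating with the same-constant rules, each step of Σ is matched by a step of Σ′; backwards, every
-- candidate W of Σ′ lies between V and V ∪ V_E for a candidate ⟨E , V⟩ of Σ, and for a solution the
-- hard same-constant rules make W equal to V ∪ V_E.
module Submission where

open import Defs
open import Data.Nat using (ℕ; zero; suc; _+_; _≤_; _⊔_; _≟_)
import Data.Nat.Properties as ℕ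
open import Data.Fin using (Fin; toℕ) renaming (zero to fzero; suc to fsuc)
import Data.Fin.Properties as Fin
open import Data.Vec using (Vec; lookup)
import Data.Vec as Vec
import Data.Vec.Properties as Vec
open import Data.List using (List; []; _∷_; _++_)
import Data.List as List
open import Data.List.Membership.Propositional using (_∈_; mapWith∈)
import Data.List.Membership.Propositional.Properties as ∈
open import Data.List.Relation.Unary.All using (All; [])
import Data.List.Relation.Unary.All as All
import Data.List.Relation.Unary.All.Properties as All
open import Data.List.Relation.Unary.Any using (here; there)
import Data.List.Relation.Unary.Any as Any
open import Data.Product using (Σ; ∃-syntax; _×_; _,_; proj₁; proj₂)
open import Data.Sum using (_⊎_; inj₁; inj₂)
open import Data.Bool using (true)
open import Data.Empty using (⊥; ⊥-elim)
open import Function using (_∘_)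
open import Relation.Nullary using (¬_; Dec; yes; no)
import Relation.Nullary.Decidable as Dec
open import Relation.Binary.Core using (_⇒_)
open import Relation.Binary.PropositionalEquality as ≡ using (_≡_; refl; cong; subst)

record IsEquivalenceOn {A : Set} (S : A → Set) (R : Rel₀ A) : Set where
  field
    refl-on : ∀ {a} → S a → R a a
    sym     : ∀ {a b} → R a b → R b a
    trans   : ∀ {a b c} → R a b → R b c → R a c
    support : ∀ {a b} → R a b → S a × S b

EqRel-map : ∀ {A : Set} {P Q : Rel₀ A} {S S′ : A → Set} → (∀ {a} → S a → S′ a) → P ⇒ Q →
            EqRel P S ⇒ EqRel Q S′
EqRel-map S⊆S′ P⊆Q (incl sa sb p) = incl (S⊆S′ sa) (S⊆S′ sb) (P⊆Q p)
EqRel-map S⊆S′ P⊆Q (refl' sa)     = refl' (S⊆S′ sa)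
EqRel-map S⊆S′ P⊆Q (sym' e)       = sym' (EqRel-map S⊆S′ P⊆Q e)
EqRel-map S⊆S′ P⊆Q (trans' e e′)  = trans' (EqRel-map S⊆S′ P⊆Q e) (EqRel-map S⊆S′ P⊆Q e′)

module _ {A : Set} {S : A → Set} where

  EqRel-support : ∀ {P : Rel₀ A} {a b} → EqRel P S a b → S a × S b
  EqRel-support (incl sa sb _) = sa , sb
  EqRel-support (refl' sa)     = sa , sa
  EqRel-support (sym' e)       = proj₂ (EqRel-support e) , proj₁ (EqRel-support e)
  EqRel-support (trans' e e′)  = proj₁ (EqRel-support e) , proj₂ (EqRel-support e′)

  EqRel-isEquivalenceOn : ∀ {P : Rel₀ A} → IsEquivalenceOn S (EqRel P S)
  EqRel-isEquivalenceOn = record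
    { refl-on = refl' ; sym = sym' ; trans = trans' ; support = EqRel-support }

  EqRel-least : ∀ {P R : Rel₀ A} → IsEquivalenceOn S R →
                (∀ {a b} → S a → S b → P a b → R a b) → EqRel P S ⇒ R
  EqRel-least isR P⊆R (incl sa sb p) = P⊆R sa sb p
  EqRel-least isR P⊆R (refl' sa)     = IsEquivalenceOn.refl-on isR sa
  EqRel-least isR P⊆R (sym' e)       = IsEquivalenceOn.sym isR (EqRel-least isR P⊆R e)
  EqRel-least isR P⊆R (trans' e e′)  =
    IsEquivalenceOn.trans isR (EqRel-least isR P⊆R e) (EqRel-least isR P⊆R e′)

  EqRel-emptyRel⇒≡ : ∀ {a b} → EqRel emptyRel S a b → a ≡ b
  EqRel-emptyRel⇒≡ (refl' _)     = refl
  EqRel-emptyRel⇒≡ (sym' e)      = ≡.sym (EqRel-emptyRel⇒≡ e)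
  EqRel-emptyRel⇒≡ (trans' e e′) = ≡.trans (EqRel-emptyRel⇒≡ e) (EqRel-emptyRel⇒≡ e′)

  ⊆-EqRel-∪₂ : ∀ {P Q : Rel₀ A} → IsEquivalenceOn S P → P ⇒ EqRel (P ∪₂ Q) S
  ⊆-EqRel-∪₂ isP p = incl (proj₁ (support p)) (proj₂ (support p)) (inj₁ p)
    where open IsEquivalenceOn isP

  IsEquivalenceOn-resp-≐ : ∀ {R R′ : Rel₀ A} → IsEquivalenceOn S R → R ≐ R′ → IsEquivalenceOn S R′
  IsEquivalenceOn-resp-≐ isR R≐R′ = record
    { refl-on = λ sa → to (refl-on sa)
    ; sym     = λ r → to (sym (from r))
    ; trans   = λ r r′ → to (trans (from r) (from r′))
    ; support = λ r → support (from r)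
    }
    where
      open IsEquivalenceOn isR
      to   = λ {a b} → proj₁ (R≐R′ a b)
      from = λ {a b} → proj₂ (R≐R′ a b)

≐-refl : ∀ {A : Set} {P : Rel₀ A} → P ≐ P
≐-refl a b = (λ p → p) , (λ p → p)

≐-sym : ∀ {A : Set} {P Q : Rel₀ A} → P ≐ Q → Q ≐ P
≐-sym P≐Q a b = proj₂ (P≐Q a b) , proj₁ (P≐Q a b)

module _ {A B : Set} where

  ∈-mapWith∈⁺ : ∀ {xs : List A} {x} (f : ∀ {y} → y ∈ xs → B) (x∈ : x ∈ xs) →
                f x∈ ∈ mapWith∈ xs f
  ∈-mapWith∈⁺ {_ ∷ xs} f (here refl) = here refl
  ∈-mapWith∈⁺ {_ ∷ xs} f (there x∈)  = there (∈-mapWith∈⁺ {xs} (λ y∈ → f (there y∈)) x∈)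

  ∈-mapWith∈⁻ : ∀ {xs : List A} {b} (f : ∀ {y} → y ∈ xs → B) → b ∈ mapWith∈ xs f →
                ∃[ x ] Σ (x ∈ xs) (λ x∈ → b ≡ f x∈)
  ∈-mapWith∈⁻ {_ ∷ xs} f (here refl) = _ , here refl , refl
  ∈-mapWith∈⁻ {_ ∷ xs} f (there b∈) with ∈-mapWith∈⁻ {xs} (λ y∈ → f (there y∈)) b∈
  ... | x , x∈ , refl = x , there x∈ , refl

module Queries (Sim : Set) (⟦_⟧ : Sim → Const → Const → Set) (Sg : Signature) where
  open ER Sim ⟦_⟧

  Typing : Set
  Typing = (R : Fin (nrel Sg)) → Fin (arity Sg R) → Ty

  withTyping : Typing → Schema
  withTyping ty = record { sig = Sg ; type = ty }

  allValues : Typing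
  allValues _ _ = tyV

  var-injective : ∀ {z w} → var z ≡ var w → z ≡ w
  var-injective refl = refl

  ∉[] : ∀ {A : Set} {x : A} → ¬ x ∈ []
  ∉[] ()

  module Substitution (x : ℕ) (c : Const) where

    substT-var≢ : ∀ {z} → ¬ z ≡ x → substT x c (var z) ≡ var z
    substT-var≢ {z} z≢x with z ≟ x
    ... | yes z≡x = ⊥-elim (z≢x z≡x)
    ... | no _    = refl

    substT-var≡ : substT x c (var x) ≡ con c
    substT-var≡ with x ≟ x
    ... | yes _   = refl
    ... | no x≢x = ⊥-elim (x≢x refl)

    substT≡var⁻ : ∀ u {z} → substT x c u ≡ var z → u ≡ var z × ¬ z ≡ x
    substT≡var⁻ (var w) e with w ≟ x
    substT≡var⁻ (var w) ()   | yes _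
    substT≡var⁻ (var w) refl | no w≢x = refl , w≢x
    substT≡var⁻ (con a) ()

    substT≡con⁻ : ∀ u {a} → substT x c u ≡ con a → u ≡ con a ⊎ (u ≡ var x × a ≡ c)
    substT≡con⁻ (var w) e with w ≟ x
    substT≡con⁻ (var w) refl | yes refl = inj₂ (refl , refl)
    substT≡con⁻ (var w) ()   | no _
    substT≡con⁻ (con b) e = inj₁ e

    module _ {q : Query Sg} where

      TermAt-substQ⁺ : ∀ {a p u} → TermAt q a p u → TermAt (substQ x c q) a p (substT x c u)
      TermAt-substQ⁺ {a} {zero}  t           = cong (substT x c) t
      TermAt-substQ⁺ {a} {suc p} (j , e , l) =
        j , e , ≡.trans (Vec.lookup-map j (substT x c) (aargs (atoms q a))) (cong (substT x c) l)

      TermAt-substQ⁻ : ∀ {a p u} → TermAt (substQ x c q) a p u →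
                       ∃[ u₀ ] (TermAt q a p u₀ × substT x c u₀ ≡ u)
      TermAt-substQ⁻ {a} {zero}  t           = u0 (atoms q a) , refl , t
      TermAt-substQ⁻ {a} {suc p} (j , e , l) =
        lookup (aargs (atoms q a)) j , (j , e , refl)
        , ≡.trans (≡.sym (Vec.lookup-map j (substT x c) (aargs (atoms q a)))) l

      OccursQ-substQ⁺ : ∀ {u} → OccursQ q u → OccursQ (substQ x c q) (substT x c u)
      OccursQ-substQ⁺ (inj₁ (a , p , t)) = inj₁ (a , p , TermAt-substQ⁺ t)
      OccursQ-substQ⁺ (inj₂ (inj₁ (u′ , inj₁ m))) = inj₂ (inj₁ (_ , inj₁ (∈.∈-map⁺ _ m)))
      OccursQ-substQ⁺ (inj₂ (inj₁ (u′ , inj₂ m))) = inj₂ (inj₁ (_ , inj₂ (∈.∈-map⁺ _ m)))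
      OccursQ-substQ⁺ (inj₂ (inj₂ (s , u′ , inj₁ m))) = inj₂ (inj₂ (s , _ , inj₁ (∈.∈-map⁺ _ m)))
      OccursQ-substQ⁺ (inj₂ (inj₂ (s , u′ , inj₂ m))) = inj₂ (inj₂ (s , _ , inj₂ (∈.∈-map⁺ _ m)))

      OccursQ-substQ⁻ : ∀ {u} → OccursQ (substQ x c q) u → ∃[ u₀ ] (OccursQ q u₀ × substT x c u₀ ≡ u)
      OccursQ-substQ⁻ (inj₁ (a , p , t)) with TermAt-substQ⁻ t
      ... | u₀ , t₀ , e = u₀ , inj₁ (a , p , t₀) , e
      OccursQ-substQ⁻ (inj₂ (inj₁ (_ , inj₁ m))) with ∈.∈-map⁻ _ m
      ... | (w , w′) , m′ , refl = w , inj₂ (inj₁ (w′ , inj₁ m′)) , refl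
      OccursQ-substQ⁻ (inj₂ (inj₁ (_ , inj₂ m))) with ∈.∈-map⁻ _ m
      ... | (w , w′) , m′ , refl = w′ , inj₂ (inj₁ (w , inj₂ m′)) , refl
      OccursQ-substQ⁻ (inj₂ (inj₂ (_ , _ , inj₁ m))) with ∈.∈-map⁻ _ m
      ... | (s , w , w′) , m′ , refl = w , inj₂ (inj₂ (s , w′ , inj₁ m′)) , refl
      OccursQ-substQ⁻ (inj₂ (inj₂ (_ , _ , inj₂ m))) with ∈.∈-map⁻ _ m
      ... | (s , w , w′) , m′ , refl = w′ , inj₂ (inj₂ (s , w , inj₂ m′)) , refl

      InSim-substQ⁻ : ∀ {z} → InSim (substQ x c q) (var z) → InSim q (var z)
      InSim-substQ⁻ (_ , _ , inj₁ m) with ∈.∈-map⁻ _ m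
      ... | (s , w , w′) , m′ , e with substT≡var⁻ w (≡.sym (cong (λ t → proj₁ (proj₂ t)) e))
      ... | refl , _ = s , w′ , inj₁ m′
      InSim-substQ⁻ (_ , _ , inj₂ m) with ∈.∈-map⁻ _ m
      ... | (s , w , w′) , m′ , e with substT≡var⁻ w′ (≡.sym (cong (λ t → proj₂ (proj₂ t)) e))
      ... | refl , _ = s , w , inj₂ m′

      neq-substQ : neq q ≡ [] → neq (substQ x c q) ≡ []
      neq-substQ e = cong (List.map _) e

      ∉InSim⇒≢ : ¬ InSim q (var x) → ∀ s u u′ → (s , u , u′) ∈ sim q →
                 ¬ u ≡ var x × ¬ u′ ≡ var x
      ∉InSim⇒≢ x∉ s u u′ m = (λ { refl → x∉ (s , u′ , inj₁ m) }) , (λ { refl → x∉ (s , u , inj₂ m) })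

  withTidCopies : (q : Query Sg) → Fin (nr q) → Fin (nr q) → ℕ → ℕ → Query Sg
  withTidCopies q a b xt yt = record
    { nr = suc (suc (nr q)) ; atoms = atoms′ ; neq = neq q ; sim = sim q }
    where
      atoms′ : Fin (suc (suc (nr q))) → RAtom Sg
      atoms′ fzero           = ratom (arel (atoms q a)) (var xt) (aargs (atoms q a))
      atoms′ (fsuc fzero)    = ratom (arel (atoms q b)) (var yt) (aargs (atoms q b))
      atoms′ (fsuc (fsuc k)) = atoms q k

  module TidCopies (q : Query Sg) (a b : Fin (nr q)) (xt yt : ℕ) where

    q⁺ : Query Sg
    q⁺ = withTidCopies q a b xt yt

    origin : Fin (nr q⁺) → Fin (nr q)
    origin fzero           = a
    origin (fsuc fzero)    = b
    origin (fsuc (fsuc k)) = k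

    arel-origin : ∀ a′ → arel (atoms q⁺ a′) ≡ arel (atoms q (origin a′))
    arel-origin fzero           = refl
    arel-origin (fsuc fzero)    = refl
    arel-origin (fsuc (fsuc k)) = refl

    TermAt-copies⁻ : ∀ {a′ p u} → TermAt q⁺ a′ p u →
      TermAt q (origin a′) p u
      ⊎ (a′ ≡ fzero × p ≡ 0 × u ≡ var xt) ⊎ (a′ ≡ fsuc fzero × p ≡ 0 × u ≡ var yt)
    TermAt-copies⁻ {fzero}           {zero}  t = inj₂ (inj₁ (refl , refl , ≡.sym t))
    TermAt-copies⁻ {fzero}           {suc p} t = inj₁ t
    TermAt-copies⁻ {fsuc fzero}      {zero}  t = inj₂ (inj₂ (refl , refl , ≡.sym t))
    TermAt-copies⁻ {fsuc fzero}      {suc p} t = inj₁ t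
    TermAt-copies⁻ {fsuc (fsuc k)}   {zero}  t = inj₁ t
    TermAt-copies⁻ {fsuc (fsuc k)}   {suc p} t = inj₁ t

    TermAt-copies⁺ : ∀ {k p u} → TermAt q k p u → TermAt q⁺ (fsuc (fsuc k)) p u
    TermAt-copies⁺ {p = zero}  t = t
    TermAt-copies⁺ {p = suc p} t = t

    OccursQ-copies⁺ : ∀ {u} → OccursQ q u → OccursQ q⁺ u
    OccursQ-copies⁺ (inj₁ (k , p , t)) = inj₁ (fsuc (fsuc k) , p , TermAt-copies⁺ t)
    OccursQ-copies⁺ (inj₂ o)           = inj₂ o

    OccursQ-copies⁻ : ∀ {u} → OccursQ q⁺ u → OccursQ q u ⊎ u ≡ var xt ⊎ u ≡ var yt
    OccursQ-copies⁻ (inj₁ (a′ , p , t)) with TermAt-copies⁻ t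
    ... | inj₁ t₀                 = inj₁ (inj₁ (origin a′ , p , t₀))
    ... | inj₂ (inj₁ (_ , _ , e)) = inj₂ (inj₁ e)
    ... | inj₂ (inj₂ (_ , _ , e)) = inj₂ (inj₂ e)
    OccursQ-copies⁻ (inj₂ o) = inj₁ (inj₂ o)

  varBound : Term → ℕ
  varBound (var z) = suc z
  varBound (con _) = 0

  vecBound : ∀ {n} → Vec Term n → ℕ
  vecBound Vec.[]       = 0
  vecBound (u Vec.∷ us) = varBound u ⊔ vecBound us

  vecBound-lookup : ∀ {n} (us : Vec Term n) j → varBound (lookup us j) ≤ vecBound us
  vecBound-lookup (u Vec.∷ us) fzero    = ℕ.m≤m⊔n (varBound u) (vecBound us)
  vecBound-lookup (u Vec.∷ us) (fsuc j) = ℕ.m≤n⇒m≤o⊔n (varBound u) (vecBound-lookup us j)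

  finBound : ∀ n → (Fin n → ℕ) → ℕ
  finBound zero    f = 0
  finBound (suc n) f = f fzero ⊔ finBound n (λ k → f (fsuc k))

  finBound-≤ : ∀ n f (k : Fin n) → f k ≤ finBound n f
  finBound-≤ (suc n) f fzero    = ℕ.m≤m⊔n (f fzero) _
  finBound-≤ (suc n) f (fsuc k) = ℕ.m≤n⇒m≤o⊔n (f fzero) (finBound-≤ n (λ k → f (fsuc k)) k)

  listBound : ∀ {A : Set} → (A → Term × Term) → List A → ℕ
  listBound π []       = 0
  listBound π (x ∷ xs) = varBound (proj₁ (π x)) ⊔ varBound (proj₂ (π x)) ⊔ listBound π xs

  listBound-∈ : ∀ {A : Set} (π : A → Term × Term) {x} xs → x ∈ xs →
    varBound (proj₁ (π x)) ≤ listBound π xs × varBound (proj₂ (π x)) ≤ listBound π xs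
  listBound-∈ π (x ∷ xs) (here refl) =
    ℕ.m≤n⇒m≤n⊔o (listBound π xs) (ℕ.m≤m⊔n _ _) , ℕ.m≤n⇒m≤n⊔o (listBound π xs) (ℕ.m≤n⊔m _ _)
  listBound-∈ π (y ∷ xs) (there m) =
    let (b₁ , b₂) = listBound-∈ π xs m
        head = varBound (proj₁ (π y)) ⊔ varBound (proj₂ (π y))
    in ℕ.m≤n⇒m≤o⊔n head b₁ , ℕ.m≤n⇒m≤o⊔n head b₂

  atomBound : RAtom Sg → ℕ
  atomBound r = varBound (u0 r) ⊔ vecBound (aargs r)

  TermAt-bound : ∀ (q : Query Sg) {a p u} → TermAt q a p u → varBound u ≤ atomBound (atoms q a)
  TermAt-bound q {a} {zero} refl = ℕ.m≤m⊔n _ _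
  TermAt-bound q {a} {suc p} (j , _ , refl) =
    ℕ.m≤n⇒m≤o⊔n (varBound (u0 (atoms q a))) (vecBound-lookup (aargs (atoms q a)) j)

  module _ (q : Query Sg) where
    private
      atomsB neqB simB : ℕ
      atomsB = finBound (nr q) (λ a → atomBound (atoms q a))
      neqB   = listBound (λ t → t) (neq q)
      simB   = listBound proj₂ (sim q)

    fresh : ℕ
    fresh = atomsB ⊔ neqB ⊔ simB

    OccursQ-bound : ∀ {u} → OccursQ q u → varBound u ≤ fresh
    OccursQ-bound (inj₁ (a , p , t)) =
      ℕ.m≤n⇒m≤n⊔o simB (ℕ.m≤n⇒m≤n⊔o neqB
        (ℕ.≤-trans (TermAt-bound q t) (finBound-≤ (nr q) (λ a → atomBound (atoms q a)) a)))
    OccursQ-bound (inj₂ (inj₁ (_ , inj₁ m))) =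
      ℕ.m≤n⇒m≤n⊔o simB (ℕ.m≤n⇒m≤o⊔n atomsB (proj₁ (listBound-∈ (λ t → t) (neq q) m)))
    OccursQ-bound (inj₂ (inj₁ (_ , inj₂ m))) =
      ℕ.m≤n⇒m≤n⊔o simB (ℕ.m≤n⇒m≤o⊔n atomsB (proj₂ (listBound-∈ (λ t → t) (neq q) m)))
    OccursQ-bound (inj₂ (inj₂ (_ , _ , inj₁ m))) =
      ℕ.m≤n⇒m≤o⊔n (atomsB ⊔ neqB) (proj₁ (listBound-∈ proj₂ (sim q) m))
    OccursQ-bound (inj₂ (inj₂ (_ , _ , inj₂ m))) =
      ℕ.m≤n⇒m≤o⊔n (atomsB ⊔ neqB) (proj₂ (listBound-∈ proj₂ (sim q) m))

    fresh-∉ : ∀ {z} → fresh ≤ z → ¬ OccursQ q (var z)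
    fresh-∉ le o = ℕ.n≮n _ (ℕ.≤-trans (OccursQ-bound o) le)

  argTerm : ∀ {n} → Fin n → ℕ → Fin n → Term
  argTerm i offset k with k Fin.≟ i
  ... | yes _ = var 2
  ... | no _  = var (offset + toℕ k)

  argTerm-cases : ∀ {n} (i : Fin n) offset k {u} → argTerm i offset k ≡ u →
    (k ≡ i × u ≡ var 2) ⊎ (¬ k ≡ i × u ≡ var (offset + toℕ k))
  argTerm-cases i offset k e with k Fin.≟ i
  ... | yes k≡i = inj₁ (k≡i , ≡.sym e)
  ... | no k≢i  = inj₂ (k≢i , ≡.sym e)

  argTerm-self : ∀ {n} (k : Fin n) offset → argTerm k offset k ≡ var 2
  argTerm-self k offset with k Fin.≟ k
  ... | yes _  = refl
  ... | no k≢k = ⊥-elim (k≢k refl)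

  -- R(x₀, …, z, …) ∧ R′(x₁, …, z, …), z = var 2 at positions i and i′, all other variables distinct.
  module SameConstant (R : Fin (nrel Sg)) (i : Fin (arity Sg R)) (R′ : Fin (nrel Sg)) (i′ : Fin (arity Sg R′)) where

    offset₀ offset₁ : ℕ
    offset₀ = 3
    offset₁ = 3 + arity Sg R

    sameAtoms : Fin 2 → RAtom Sg
    sameAtoms fzero        = ratom R  (var 0) (Vec.tabulate (argTerm i offset₀))
    sameAtoms (fsuc fzero) = ratom R′ (var 1) (Vec.tabulate (argTerm i′ offset₁))

    query : Query Sg
    query = record { nr = 2 ; atoms = sameAtoms ; neq = [] ; sim = [] }

    data Loc : Fin 2 → ℕ → ℕ → Set where
      tid₀  : Loc fzero 0 0
      tid₁  : Loc (fsuc fzero) 0 1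
      same₀ : Loc fzero (suc (toℕ i)) 2
      same₁ : Loc (fsuc fzero) (suc (toℕ i′)) 2
      arg₀  : (k : Fin (arity Sg R))  → ¬ k ≡ i  → Loc fzero (suc (toℕ k)) (offset₀ + toℕ k)
      arg₁  : (k : Fin (arity Sg R′)) → ¬ k ≡ i′ → Loc (fsuc fzero) (suc (toℕ k)) (offset₁ + toℕ k)

    TermAt⇒Loc : ∀ {a p z} → TermAt query a p (var z) → Loc a p z
    TermAt⇒Loc {fzero}      {zero}  refl = tid₀
    TermAt⇒Loc {fsuc fzero} {zero}  refl = tid₁
    TermAt⇒Loc {fzero}      {suc p} (k , refl , l)
      with argTerm-cases i offset₀ k (≡.trans (≡.sym (Vec.lookup∘tabulate _ k)) l)
    ... | inj₁ (refl , refl) = same₀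
    ... | inj₂ (k≢i , refl)  = arg₀ k k≢i
    TermAt⇒Loc {fsuc fzero} {suc p} (k , refl , l)
      with argTerm-cases i′ offset₁ k (≡.trans (≡.sym (Vec.lookup∘tabulate _ k)) l)
    ... | inj₁ (refl , refl) = same₁
    ... | inj₂ (k≢i , refl)  = arg₁ k k≢i

    TermAt-con-absurd : ∀ {a p c} → ¬ TermAt query a p (con c)
    TermAt-con-absurd {fzero}      {zero}  ()
    TermAt-con-absurd {fsuc fzero} {zero}  ()
    TermAt-con-absurd {fzero}      {suc p} (k , refl , l)
      with argTerm-cases i offset₀ k (≡.trans (≡.sym (Vec.lookup∘tabulate _ k)) l)
    ... | inj₁ (_ , ())
    ... | inj₂ (_ , ())
    TermAt-con-absurd {fsuc fzero} {suc p} (k , refl , l)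
      with argTerm-cases i′ offset₁ k (≡.trans (≡.sym (Vec.lookup∘tabulate _ k)) l)
    ... | inj₁ (_ , ())
    ... | inj₂ (_ , ())

    private
      offset₀-disjoint : ∀ (k : Fin (arity Sg R)) n → ¬ toℕ k ≡ arity Sg R + n
      offset₀-disjoint k n = ℕ.<⇒≢ (ℕ.<-≤-trans (Fin.toℕ<n k) (ℕ.m≤m+n (arity Sg R) n))

    Loc-unique : ∀ {a p z a′ p′ z′} → Loc a p z → Loc a′ p′ z′ → z ≡ z′ → ¬ z ≡ 2 →
                 a ≡ a′ × p ≡ p′
    Loc-unique same₀ _ _ z≢2 = ⊥-elim (z≢2 refl)
    Loc-unique same₁ _ _ z≢2 = ⊥-elim (z≢2 refl)
    Loc-unique _ same₀ e z≢2 = ⊥-elim (z≢2 e)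
    Loc-unique _ same₁ e z≢2 = ⊥-elim (z≢2 e)
    Loc-unique tid₀ tid₀ _ _ = refl , refl
    Loc-unique tid₁ tid₁ _ _ = refl , refl
    Loc-unique (arg₀ k _) (arg₀ k′ _) e _ = refl , cong suc (ℕ.+-cancelˡ-≡ 3 _ _ e)
    Loc-unique (arg₀ k _) (arg₁ k′ _) e _ = ⊥-elim (offset₀-disjoint k (toℕ k′) (ℕ.+-cancelˡ-≡ 3 _ _ e))
    Loc-unique (arg₁ k _) (arg₀ k′ _) e _ =
      ⊥-elim (offset₀-disjoint k′ (toℕ k) (≡.sym (ℕ.+-cancelˡ-≡ 3 _ _ e)))
    Loc-unique (arg₁ k _) (arg₁ k′ _) e _ =
      refl , cong suc (ℕ.+-cancelˡ-≡ (arity Sg R) _ _ (ℕ.+-cancelˡ-≡ 3 _ _ e))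
    Loc-unique tid₀ tid₁ ()
    Loc-unique tid₀ (arg₀ _ _) ()
    Loc-unique tid₀ (arg₁ _ _) ()
    Loc-unique tid₁ tid₀ ()
    Loc-unique tid₁ (arg₀ _ _) ()
    Loc-unique tid₁ (arg₁ _ _) ()
    Loc-unique (arg₀ _ _) tid₀ ()
    Loc-unique (arg₀ _ _) tid₁ ()
    Loc-unique (arg₁ _ _) tid₀ ()
    Loc-unique (arg₁ _ _) tid₁ ()

    ∉InSim : ∀ z → ¬ InSim query (var z)
    ∉InSim z (_ , _ , inj₁ ())
    ∉InSim z (_ , _ , inj₂ ())

  module Semantics (D : Database Sg) where

    hSet : (q : Query Sg) → (Fin (nr q) → ℕ → Const → Set) → Term → Const → Set
    hSet q g (var z) c = Dom D c × (∀ a p → TermAt q a p (var z) → g a p c)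
    hSet q g (con a) c = c ≡ a

    -- Sat with its existentials unpacked; hSet is the set h(u), which Sat defines locally.
    record Satisfaction (ty : Typing) (E : Rel₀ Const) (V : Rel₀ Cell) (q : Query Sg) : Set₁ where
      field
        g            : Fin (nr q) → ℕ → Const → Set
        atomFact     : Fin (nr q) → Fact Sg
        atomFact∈D   : ∀ a → atomFact a ∈ D
        atomFact-rel : ∀ a → rel (atomFact a) ≡ arel (atoms q a)
        g-tid        : ∀ a c → g a 0 c iff (c ≡ tidc (tidOf (atomFact a)))
        g-cell       : ∀ a j c → g a (suc (toℕ j)) c iff cellSet (withTyping ty) D E V (atomFact a) j c
        g-con        : ∀ a p c → TermAt q a p (con c) → g a p c
        h-nonempty   : ∀ z → OccursQ q (var z) → ∃[ c ] hSet q g (var z) c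
        con-dom      : ∀ c → OccursQ q (con c) → Dom D c
        neq-disjoint : ∀ u u′ → (u , u′) ∈ neq q → ∀ c → hSet q g u c → hSet q g u′ c → ⊥
        sim-witness  : ∀ s u u′ → (s , u , u′) ∈ sim q →
                       ∃[ c ] ∃[ c′ ] (hSet q g u c × hSet q g u′ c′ × ⟦ s ⟧ c c′)

    Sat⇒Satisfaction : ∀ {ty E V q} → Sat (withTyping ty) D E V q → Satisfaction ty E V q
    Sat⇒Satisfaction {q = q} (g , at , gc , nz , dm , nq , sm) = record
      { g = g ; atomFact = λ a → proj₁ (at a) ; atomFact∈D = λ a → proj₁ (proj₂ (at a))
      ; atomFact-rel = λ a → proj₁ (proj₂ (proj₂ (at a)))
      ; g-tid = λ a → proj₁ (proj₂ (proj₂ (proj₂ (at a))))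
      ; g-cell = λ a → proj₂ (proj₂ (proj₂ (proj₂ (at a))))
      ; g-con = gc ; h-nonempty = nz ; con-dom = dm ; neq-disjoint = nq′ ; sim-witness = sm′ }
      where
        nq′ : ∀ u u′ → (u , u′) ∈ neq q → ∀ c → hSet q g u c → hSet q g u′ c → ⊥
        nq′ (var _) (var _) = nq _ _
        nq′ (var _) (con _) = nq _ _
        nq′ (con _) (var _) = nq _ _
        nq′ (con _) (con _) = nq _ _
        sm′ : ∀ s u u′ → (s , u , u′) ∈ sim q →
              ∃[ c ] ∃[ c′ ] (hSet q g u c × hSet q g u′ c′ × ⟦ s ⟧ c c′)
        sm′ s (var _) (var _) = sm s _ _
        sm′ s (var _) (con _) = sm s _ _
        sm′ s (con _) (var _) = sm s _ _
        sm′ s (con _) (con _) = sm s _ _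

    Satisfaction⇒Sat : ∀ {ty E V q} → Satisfaction ty E V q → Sat (withTyping ty) D E V q
    Satisfaction⇒Sat s =
      g , (λ a → atomFact a , atomFact∈D a , atomFact-rel a , g-tid a , g-cell a)
        , g-con , h-nonempty , con-dom , nq′ , sm′
      where
        open Satisfaction s
        nq′ : _
        nq′ (var _) (var _) = neq-disjoint _ _
        nq′ (var _) (con _) = neq-disjoint _ _
        nq′ (con _) (var _) = neq-disjoint _ _
        nq′ (con _) (con _) = neq-disjoint _ _
        sm′ : _
        sm′ s (var _) (var _) = sim-witness s _ _
        sm′ s (var _) (con _) = sim-witness s _ _
        sm′ s (con _) (var _) = sim-witness s _ _
        sm′ s (con _) (con _) = sim-witness s _ _

    CellSets⊆ : Typing → Rel₀ Const → Rel₀ Cell → Typing → Rel₀ Const → Rel₀ Cell → Set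
    CellSets⊆ ty E V ty′ E′ V′ =
      ∀ f → f ∈ D → ∀ j c → cellSet (withTyping ty) D E V f j c → cellSet (withTyping ty′) D E′ V′ f j c

    Satisfaction-transfer : ∀ {ty E V ty′ E′ V′ q} →
      CellSets⊆ ty E V ty′ E′ V′ → CellSets⊆ ty′ E′ V′ ty E V →
      Satisfaction ty E V q → Satisfaction ty′ E′ V′ q
    Satisfaction-transfer to from s = record
      { g = g ; atomFact = atomFact ; atomFact∈D = atomFact∈D ; atomFact-rel = atomFact-rel ; g-tid = g-tid
      ; g-cell = λ a j c → (λ x → to (atomFact a) (atomFact∈D a) j c (proj₁ (g-cell a j c) x))
                         , (λ y → proj₂ (g-cell a j c) (from (atomFact a) (atomFact∈D a) j c y))
      ; g-con = g-con ; h-nonempty = h-nonempty ; con-dom = con-dom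
      ; neq-disjoint = neq-disjoint ; sim-witness = sim-witness }
      where open Satisfaction s

    Sat-transfer : ∀ {ty E V ty′ E′ V′ q} →
      CellSets⊆ ty E V ty′ E′ V′ → CellSets⊆ ty′ E′ V′ ty E V →
      Sat (withTyping ty) D E V q → Sat (withTyping ty′) D E′ V′ q
    Sat-transfer to from = Satisfaction⇒Sat ∘ Satisfaction-transfer to from ∘ Sat⇒Satisfaction

    reindex : ∀ {R R′ : Fin (nrel Sg)} → R ≡ R′ → (j : Fin (arity Sg R′)) →
              ∃[ j′ ] (toℕ {arity Sg R} j′ ≡ toℕ j)
    reindex refl j = j , refl

    canonicalG : ∀ ty E V {q : Query Sg} → (Fin (nr q) → Fact Sg) → Fin (nr q) → ℕ → Const → Set
    canonicalG ty E V f a zero    c = c ≡ tidc (tidOf (f a))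
    canonicalG ty E V f a (suc p) c = ∃[ j ] (toℕ j ≡ p × cellSet (withTyping ty) D E V (f a) j c)

    canonicalG-cell : ∀ ty E V {q : Query Sg} (f : Fin (nr q) → Fact Sg) a j c →
      canonicalG ty E V {q} f a (suc (toℕ j)) c iff cellSet (withTyping ty) D E V (f a) j c
    canonicalG-cell ty E V f a j c =
      (λ { (j′ , e , x) → subst (λ k → cellSet (withTyping ty) D E V (f a) k c) (Fin.toℕ-injective e) x })
      , λ y → j , refl , y

    module _ {ty ty′ : Typing} {E E′ : Rel₀ Const} {V V′ : Rel₀ Cell} {q : Query Sg}
             (grow : CellSets⊆ ty E V ty′ E′ V′)
             (s : Satisfaction ty E V q) where
      open Satisfaction s

      g↑ : Fin (nr q) → ℕ → Const → Set
      g↑ = canonicalG ty′ E′ V′ {q} atomFact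

      g⊆g↑ : ∀ {a p u c} → TermAt q a p u → g a p c → g↑ a p c
      g⊆g↑ {a} {zero}  t x = proj₁ (g-tid a _) x
      g⊆g↑ {a} {suc p} {c = c} (j , refl , _) x with reindex (atomFact-rel a) j
      ... | j′ , e = j′ , e , grow (atomFact a) (atomFact∈D a) j′ c
                                (proj₁ (g-cell a j′ c) (subst (λ k → g a (suc k) c) (≡.sym e) x))

      hSet-mono : ∀ u {c} → hSet q g u c → hSet q g↑ u c
      hSet-mono (var z) (d , all) = d , λ a p t → g⊆g↑ t (all a p t)
      hSet-mono (con x) e         = e

      -- Inequalities are the only condition that growing the cell sets can break.
      Satisfaction-mono : neq q ≡ [] → Satisfaction ty′ E′ V′ q
      Satisfaction-mono noNeq = record
        { g = g↑ ; atomFact = atomFact ; atomFact∈D = atomFact∈D ; atomFact-rel = atomFact-rel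
        ; g-tid = λ a c → (λ x → x) , (λ x → x)
        ; g-cell = canonicalG-cell ty′ E′ V′ {q} atomFact
        ; g-con = λ a p c t → g⊆g↑ t (g-con a p c t)
        ; h-nonempty = λ z o → proj₁ (h-nonempty z o) , hSet-mono (var z) (proj₂ (h-nonempty z o))
        ; con-dom = con-dom
        ; neq-disjoint = λ u u′ m → ⊥-elim (∉[] (subst ((u , u′) ∈_) noNeq m))
        ; sim-witness = λ s u u′ m → let (c , c′ , h , h′ , x) = sim-witness s u u′ m
                                     in c , c′ , hSet-mono u h , hSet-mono u′ h′ , x }

    module _ (x : ℕ) (c : Const) {q : Query Sg} {ty : Typing} {E : Rel₀ Const} {V : Rel₀ Cell} (noNeq : neq q ≡ [])
             (x∉sim : ¬ InSim q (var x)) where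
      open Substitution x c

      module _ (s : Satisfaction ty E V (substQ x c q)) where
        open Satisfaction s

        hSet-substQ-var : OccursQ q (var x) → hSet q g (var x) c
        hSet-substQ-var o =
          con-dom c (subst (OccursQ _) substT-var≡ (OccursQ-substQ⁺ o))
          , λ a p t → g-con a p c (subst (TermAt _ a p) substT-var≡ (TermAt-substQ⁺ t))

        hSet-substQ⁻ : ∀ u {c′} → ¬ u ≡ var x → hSet (substQ x c q) g (substT x c u) c′ → hSet q g u c′
        hSet-substQ⁻ (var z) {c′} u≢x h =
          let (d , all) = subst (λ w → hSet _ g w c′) (substT-var≢ z≢x) h
          in d , λ a p t → all a p (subst (TermAt _ a p) (substT-var≢ z≢x) (TermAt-substQ⁺ t))
          where
            z≢x : ¬ z ≡ x
            z≢x e = u≢x (cong var e)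
        hSet-substQ⁻ (con a) _ h = h

        Satisfaction-substQ⁻ : Satisfaction ty E V q
        Satisfaction-substQ⁻ = record
          { g = g ; atomFact = atomFact ; atomFact∈D = atomFact∈D ; atomFact-rel = atomFact-rel
          ; g-tid = g-tid ; g-cell = g-cell
          ; g-con = λ a p c′ t → g-con a p c′ (TermAt-substQ⁺ t)
          ; h-nonempty = nonempty
          ; con-dom = λ c′ o → con-dom c′ (OccursQ-substQ⁺ o)
          ; neq-disjoint = λ u u′ m → ⊥-elim (∉[] (subst ((u , u′) ∈_) noNeq m))
          ; sim-witness = λ s′ u u′ m →
              let (c₁ , c₂ , h₁ , h₂ , r) = sim-witness s′ _ _ (∈.∈-map⁺ _ m)
                  (u≢x , u′≢x)           = ∉InSim⇒≢ {q} x∉sim s′ u u′ m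
              in c₁ , c₂ , hSet-substQ⁻ u u≢x h₁ , hSet-substQ⁻ u′ u′≢x h₂ , r }
          where
            nonempty : ∀ z → OccursQ q (var z) → ∃[ c′ ] hSet q g (var z) c′
            nonempty z o with z ≟ x
            ... | yes refl = c , hSet-substQ-var o
            ... | no z≢x with h-nonempty z (subst (OccursQ _) (substT-var≢ z≢x) (OccursQ-substQ⁺ o))
            ... | c′ , d , all =
              c′ , d , λ a p t → all a p (subst (TermAt _ a p) (substT-var≢ z≢x) (TermAt-substQ⁺ t))

      module _ (s : Satisfaction ty E V q) (hx : hSet q (Satisfaction.g s) (var x) c) where
        open Satisfaction s

        hSet-substQ⁺ : ∀ w {c′} → ¬ w ≡ var x → hSet q g w c′ → hSet (substQ x c q) g (substT x c w) c′
        hSet-substQ⁺ (var z) {c′} w≢x (d , all) =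
          subst (λ w → hSet _ g w c′) (≡.sym (substT-var≢ (λ e → w≢x (cong var e)))) (d , all′)
          where
            all′ : ∀ a p → TermAt (substQ x c q) a p (var z) → g a p c′
            all′ a p t with TermAt-substQ⁻ t
            ... | u₁ , t₁ , e₁ with substT≡var⁻ u₁ e₁
            ... | refl , _ = all a p t₁
        hSet-substQ⁺ (con a) _ h = h

        Satisfaction-substQ⁺ : Satisfaction ty E V (substQ x c q)
        Satisfaction-substQ⁺ = record
          { g = g ; atomFact = atomFact ; atomFact∈D = atomFact∈D ; atomFact-rel = atomFact-rel
          ; g-tid = g-tid ; g-cell = g-cell ; g-con = gc ; h-nonempty = nonempty ; con-dom = dm
          ; neq-disjoint = λ u u′ m → ⊥-elim (∉[] (subst ((u , u′) ∈_) (neq-substQ {q} noNeq) m))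
          ; sim-witness = sm }
          where
            gc : ∀ a p c′ → TermAt (substQ x c q) a p (con c′) → g a p c′
            gc a p c′ t with TermAt-substQ⁻ t
            ... | u₀ , t₀ , e with substT≡con⁻ u₀ e
            ... | inj₁ refl         = g-con a p c′ t₀
            ... | inj₂ (refl , refl) = proj₂ hx a p t₀

            nonempty : ∀ z → OccursQ (substQ x c q) (var z) → ∃[ c′ ] hSet (substQ x c q) g (var z) c′
            nonempty z o with OccursQ-substQ⁻ o
            ... | u₀ , o₀ , e with substT≡var⁻ u₀ e
            ... | refl , z≢x = proj₁ (h-nonempty z o₀)
                             , subst (λ w → hSet _ g w _) (substT-var≢ z≢x)
                                     (hSet-substQ⁺ (var z) (λ e → z≢x (var-injective e)) (proj₂ (h-nonempty z o₀)))

            dm : ∀ c′ → OccursQ (substQ x c q) (con c′) → Dom D c′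
            dm c′ o with OccursQ-substQ⁻ o
            ... | u₀ , o₀ , e with substT≡con⁻ u₀ e
            ... | inj₁ refl         = con-dom c′ o₀
            ... | inj₂ (refl , refl) = proj₁ hx

            sm : ∀ s′ u u′ → (s′ , u , u′) ∈ sim (substQ x c q) →
                 ∃[ c₁ ] ∃[ c₂ ] (hSet (substQ x c q) g u c₁ × hSet (substQ x c q) g u′ c₂
                                  × ⟦ s′ ⟧ c₁ c₂)
            sm s′ _ _ m with ∈.∈-map⁻ _ m
            ... | (_ , w , w′) , m₁ , refl with sim-witness _ w w′ m₁
            ... | c₁ , c₂ , h₁ , h₂ , r =
              let (w≢x , w′≢x) = ∉InSim⇒≢ {q} x∉sim _ w w′ m₁
              in c₁ , c₂ , hSet-substQ⁺ w w≢x h₁ , hSet-substQ⁺ w′ w′≢x h₂ , r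

    module _ {ty : Typing} {E : Rel₀ Const} {V : Rel₀ Cell} (q : Query Sg) (x y : ℕ) {c c′ : Const}
             (noNeq : neq q ≡ [])
             (x∉sim : ¬ InSim q (var x)) (y∉sim : ¬ InSim q (var y)) where
      private
        qx = substQ x c q
        noNeq-qx : neq qx ≡ []
        noNeq-qx = Substitution.neq-substQ x c {q} noNeq
        y∉sim-qx : ¬ InSim qx (var y)
        y∉sim-qx i = y∉sim (Substitution.InSim-substQ⁻ x c {q} i)

      Ans⇒Satisfaction : Ans (withTyping ty) D E V q x y c c′ → OccursQ q (var x) → OccursQ q (var y) →
        Σ (Satisfaction ty E V q) (λ s → hSet q (Satisfaction.g s) (var x) c × hSet q (Satisfaction.g s) (var y) c′)
      Ans⇒Satisfaction (x≡y⇒c≡c′ , sat) ox oy = s , hx , hy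
        where
          open Substitution x c
          s₁ : Satisfaction ty E V qx
          s₁ = Satisfaction-substQ⁻ y c′ {qx} noNeq-qx y∉sim-qx (Sat⇒Satisfaction sat)
          s : Satisfaction ty E V q
          s = Satisfaction-substQ⁻ x c {q} noNeq x∉sim s₁
          hx : hSet q (Satisfaction.g s) (var x) c
          hx = hSet-substQ-var x c {q} noNeq x∉sim s₁ ox
          hy : hSet q (Satisfaction.g s) (var y) c′
          hy with x ≟ y
          ... | yes refl = subst (hSet q (Satisfaction.g s) (var x)) (x≡y⇒c≡c′ refl) hx
          ... | no x≢y   =
            hSet-substQ⁻ x c {q} noNeq x∉sim s₁ (var y) (λ e → x≢y (≡.sym (var-injective e)))
              (subst (λ u → hSet qx (Satisfaction.g s₁) u c′) (≡.sym (substT-var≢ (λ e → x≢y (≡.sym e))))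
                (hSet-substQ-var y c′ {qx} noNeq-qx y∉sim-qx (Sat⇒Satisfaction sat)
                  (subst (OccursQ qx) (substT-var≢ (λ e → x≢y (≡.sym e))) (OccursQ-substQ⁺ {q} oy))))

      Satisfaction⇒Ans : (x ≡ y → c ≡ c′) → (s : Satisfaction ty E V q) →
        hSet q (Satisfaction.g s) (var x) c → hSet q (Satisfaction.g s) (var y) c′ →
        Ans (withTyping ty) D E V q x y c c′
      Satisfaction⇒Ans x≡y⇒c≡c′ s hx hy =
        x≡y⇒c≡c′ , Satisfaction⇒Sat (Satisfaction-substQ⁺ y c′ {qx} noNeq-qx y∉sim-qx s₁ hy′)
        where
          open Substitution x c
          s₁ : Satisfaction ty E V qx
          s₁ = Satisfaction-substQ⁺ x c {q} noNeq x∉sim s hx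
          hy′ : hSet qx (Satisfaction.g s) (var y) c′
          hy′ with x ≟ y
          ... | yes refl = proj₁ hy , λ a p t → ⊥-elim (x-eliminated t)
            where
              x-eliminated : ∀ {a p} → ¬ TermAt qx a p (var x)
              x-eliminated t with TermAt-substQ⁻ {q} t
              ... | u₀ , _ , e = proj₂ (substT≡var⁻ u₀ e) refl
          ... | no x≢y   =
            subst (λ u → hSet qx (Satisfaction.g s) u c′) (substT-var≢ (λ e → x≢y (≡.sym e)))
              (hSet-substQ⁺ x c {q} noNeq x∉sim s hx (var y) (λ e → x≢y (≡.sym (var-injective e))) hy)

    module _ (q : Query Sg) (a b : Fin (nr q)) (xt yt : ℕ) where
      open TidCopies q a b xt yt

      hSet-copies⁻ : ∀ {G} u {c} → hSet q⁺ G u c → hSet q (λ k → G (fsuc (fsuc k))) u c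
      hSet-copies⁻ (var z) (d , all) = d , λ k p t → all (fsuc (fsuc k)) p (TermAt-copies⁺ t)
      hSet-copies⁻ (con _) h         = h

    module _ (q : Query Sg) (a b : Fin (nr q)) (xt yt : ℕ) {ty : Typing} {E : Rel₀ Const} {V : Rel₀ Cell} where
      open TidCopies q a b xt yt

      module _ (xt∉q : ¬ OccursQ q (var xt)) (yt∉q : ¬ OccursQ q (var yt)) (xt≢yt : ¬ xt ≡ yt)
               (s : Satisfaction ty E V q) where
        open Satisfaction s

        g⁺ : Fin (nr q⁺) → ℕ → Const → Set
        g⁺ a′ = g (origin a′)

        hSet-copies⁺ : ∀ u {c} → OccursQ q u → hSet q g u c → hSet q⁺ g⁺ u c
        hSet-copies⁺ (var z) o (d , all) = d , all′
          where
            all′ : ∀ a′ p → TermAt q⁺ a′ p (var z) → g⁺ a′ p _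
            all′ a′ p t with TermAt-copies⁻ t
            ... | inj₁ t₀                 = all (origin a′) p t₀
            ... | inj₂ (inj₁ (_ , _ , e)) = ⊥-elim (xt∉q (subst (OccursQ q) e o))
            ... | inj₂ (inj₂ (_ , _ , e)) = ⊥-elim (yt∉q (subst (OccursQ q) e o))
        hSet-copies⁺ (con _) o h = h

        hSet-xt : hSet q⁺ g⁺ (var xt) (tidc (tidOf (atomFact a)))
        hSet-xt = (atomFact a , atomFact∈D a , inj₁ refl) , all′
          where
            all′ : ∀ a′ p → TermAt q⁺ a′ p (var xt) → g⁺ a′ p (tidc (tidOf (atomFact a)))
            all′ a′ p t with TermAt-copies⁻ t
            ... | inj₁ t₀                       = ⊥-elim (xt∉q (inj₁ (origin a′ , p , t₀)))
            ... | inj₂ (inj₁ (refl , refl , _)) = proj₂ (g-tid a _) refl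
            ... | inj₂ (inj₂ (_ , _ , e))       = ⊥-elim (xt≢yt (var-injective e))

        hSet-yt : hSet q⁺ g⁺ (var yt) (tidc (tidOf (atomFact b)))
        hSet-yt = (atomFact b , atomFact∈D b , inj₁ refl) , all′
          where
            all′ : ∀ a′ p → TermAt q⁺ a′ p (var yt) → g⁺ a′ p (tidc (tidOf (atomFact b)))
            all′ a′ p t with TermAt-copies⁻ t
            ... | inj₁ t₀                       = ⊥-elim (yt∉q (inj₁ (origin a′ , p , t₀)))
            ... | inj₂ (inj₁ (_ , _ , e))       = ⊥-elim (xt≢yt (≡.sym (var-injective e)))
            ... | inj₂ (inj₂ (refl , refl , _)) = proj₂ (g-tid b _) refl

        Satisfaction-copies⁺ : Satisfaction ty E V q⁺
        Satisfaction-copies⁺ = record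
          { g = g⁺ ; atomFact = λ a′ → atomFact (origin a′) ; atomFact∈D = λ a′ → atomFact∈D (origin a′)
          ; atomFact-rel = λ a′ → ≡.trans (atomFact-rel (origin a′)) (≡.sym (arel-origin a′))
          ; g-tid = λ a′ → g-tid (origin a′) ; g-cell = λ a′ → g-cell (origin a′)
          ; g-con = gc ; h-nonempty = nonempty ; con-dom = dm
          ; neq-disjoint = λ u u′ m c h h′ →
              neq-disjoint u u′ m c (hSet-copies⁻ q a b xt yt {g⁺} u h) (hSet-copies⁻ q a b xt yt {g⁺} u′ h′)
          ; sim-witness = λ s′ u u′ m → let (c₁ , c₂ , h₁ , h₂ , r) = sim-witness s′ u u′ m in
              c₁ , c₂ , hSet-copies⁺ u (inj₂ (inj₂ (s′ , u′ , inj₁ m))) h₁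
                      , hSet-copies⁺ u′ (inj₂ (inj₂ (s′ , u , inj₂ m))) h₂ , r }
          where
            gc : ∀ a′ p c → TermAt q⁺ a′ p (con c) → g⁺ a′ p c
            gc a′ p c t with TermAt-copies⁻ t
            ... | inj₁ t₀ = g-con (origin a′) p c t₀
            ... | inj₂ (inj₁ (_ , _ , ()))
            ... | inj₂ (inj₂ (_ , _ , ()))

            nonempty : ∀ z → OccursQ q⁺ (var z) → ∃[ c ] hSet q⁺ g⁺ (var z) c
            nonempty z o with OccursQ-copies⁻ o
            ... | inj₁ o₀ = proj₁ (h-nonempty z o₀) , hSet-copies⁺ (var z) o₀ (proj₂ (h-nonempty z o₀))
            ... | inj₂ (inj₁ refl) = _ , hSet-xt
            ... | inj₂ (inj₂ refl) = _ , hSet-yt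

            dm : ∀ c → OccursQ q⁺ (con c) → Dom D c
            dm c o with OccursQ-copies⁻ o
            ... | inj₁ o₀ = con-dom c o₀
            ... | inj₂ (inj₁ ())
            ... | inj₂ (inj₂ ())

      module _ (noNeq : neq q ≡ []) (s : Satisfaction ty E V q⁺) where
        open Satisfaction s

        g⁻ : Fin (nr q) → ℕ → Const → Set
        g⁻ k = g (fsuc (fsuc k))

        Satisfaction-copies⁻ : Satisfaction ty E V q
        Satisfaction-copies⁻ = record
          { g = g⁻ ; atomFact = λ k → atomFact (fsuc (fsuc k)) ; atomFact∈D = λ k → atomFact∈D (fsuc (fsuc k))
          ; atomFact-rel = λ k → atomFact-rel (fsuc (fsuc k))
          ; g-tid = λ k → g-tid (fsuc (fsuc k)) ; g-cell = λ k → g-cell (fsuc (fsuc k))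
          ; g-con = λ k p c t → g-con (fsuc (fsuc k)) p c (TermAt-copies⁺ t)
          ; h-nonempty = λ z o → proj₁ (h-nonempty z (OccursQ-copies⁺ o))
                               , hSet-copies⁻ q a b xt yt {g} (var z) (proj₂ (h-nonempty z (OccursQ-copies⁺ o)))
          ; con-dom = λ c o → con-dom c (OccursQ-copies⁺ o)
          ; neq-disjoint = λ u u′ m → ⊥-elim (∉[] (subst ((u , u′) ∈_) noNeq m))
          ; sim-witness = λ s′ u u′ m → let (c₁ , c₂ , h₁ , h₂ , r) = sim-witness s′ u u′ m in
              c₁ , c₂ , hSet-copies⁻ q a b xt yt {g} u h₁ , hSet-copies⁻ q a b xt yt {g} u′ h₂ , r }

    ValAt-self : ∀ {f} → f ∈ D → ∀ j → ValAt D (tidOf f) (suc (toℕ j)) (lookup (args f) j)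
    ValAt-self {f} f∈ j = f , f∈ , refl , j , refl , refl

    ValAt⇒Cells : ∀ {t i a} → ValAt D t i a → Cells (withTyping allValues) D (t , i)
    ValAt⇒Cells (f , f∈ , tf , j , ij , _) = f , f∈ , tf , j , ij , refl

    module _ (f f′ : Fact Sg) (f∈ : f ∈ D) (f′∈ : f′ ∈ D)
             (j : Fin (arity Sg (rel f))) (j′ : Fin (arity Sg (rel f′)))
             (same : lookup (args f) j ≡ lookup (args f′) j′) {E : Rel₀ Const} {W : Rel₀ Cell}
             (W-refl : ∀ c → Cells (withTyping allValues) D c → W c c) where
      open SameConstant (rel f) j (rel f′) j′

      private
        facts : Fin 2 → Fact Sg
        facts fzero        = f
        facts (fsuc fzero) = f′

        facts∈D : ∀ a → facts a ∈ D
        facts∈D fzero        = f∈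
        facts∈D (fsuc fzero) = f′∈

        facts-rel : ∀ a → rel (facts a) ≡ arel (atoms query a)
        facts-rel fzero        = refl
        facts-rel (fsuc fzero) = refl

        g : Fin 2 → ℕ → Const → Set
        g = canonicalG allValues E W {query} facts

        g-self : ∀ a (k : Fin (arity Sg (rel (facts a)))) → g a (suc (toℕ k)) (lookup (args (facts a)) k)
        g-self a k = k , refl , _ , _ , W-refl _ (ValAt⇒Cells (ValAt-self (facts∈D a) k))
                   , ValAt-self (facts∈D a) k

        dom-self : ∀ a (k : Fin (arity Sg (rel (facts a)))) → Dom D (lookup (args (facts a)) k)
        dom-self a k = facts a , facts∈D a , inj₂ (k , refl)

        witness : ∀ {a p z} → Loc a p z → ∃[ c ] (Dom D c × g a p c)
        witness tid₀       = tidc (tidOf f)  , (f  , f∈  , inj₁ refl) , refl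
        witness tid₁       = tidc (tidOf f′) , (f′ , f′∈ , inj₁ refl) , refl
        witness same₀      = _ , dom-self fzero j , g-self fzero j
        witness same₁      = _ , dom-self (fsuc fzero) j′ , g-self (fsuc fzero) j′
        witness (arg₀ k _) = _ , dom-self fzero k , g-self fzero k
        witness (arg₁ k _) = _ , dom-self (fsuc fzero) k , g-self (fsuc fzero) k

        unshared-hSet : ∀ {a p z} → Loc a p z → ¬ z ≡ 2 → ∃[ c ] hSet query g (var z) c
        unshared-hSet l z≢2 = proj₁ (witness l) , proj₁ (proj₂ (witness l)) , all
          where
            all : ∀ a p → TermAt query a p (var _) → g a p (proj₁ (witness l))
            all a p t with Loc-unique l (TermAt⇒Loc t) refl z≢2
            ... | refl , refl = proj₂ (proj₂ (witness l))

        shared-hSet : hSet query g (var 2) (lookup (args f) j)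
        shared-hSet = dom-self fzero j , all
          where
            all : ∀ a p → TermAt query a p (var 2) → g a p (lookup (args f) j)
            all a p t with TermAt⇒Loc t
            ... | same₀ = g-self fzero j
            ... | same₁ = subst (g (fsuc fzero) (suc (toℕ j′))) (≡.sym same) (g-self (fsuc fzero) j′)

        nonempty : ∀ z → OccursQ query (var z) → ∃[ c ] hSet query g (var z) c
        nonempty z (inj₁ (a , p , t)) with TermAt⇒Loc t
        ... | tid₀         = unshared-hSet tid₀ (λ ())
        ... | tid₁         = unshared-hSet tid₁ (λ ())
        ... | same₀        = _ , shared-hSet
        ... | same₁        = _ , shared-hSet
        ... | arg₀ k k≢i   = unshared-hSet (arg₀ k k≢i) (λ ())
        ... | arg₁ k k≢i   = unshared-hSet (arg₁ k k≢i) (λ ())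
        nonempty z (inj₂ (inj₁ (_ , inj₁ ())))
        nonempty z (inj₂ (inj₁ (_ , inj₂ ())))
        nonempty z (inj₂ (inj₂ (_ , _ , inj₁ ())))
        nonempty z (inj₂ (inj₂ (_ , _ , inj₂ ())))

        satisfaction : Satisfaction allValues E W query
        satisfaction = record
          { g = g ; atomFact = facts ; atomFact∈D = facts∈D ; atomFact-rel = facts-rel
          ; g-tid = λ a c → (λ x → x) , (λ x → x)
          ; g-cell = canonicalG-cell allValues E W {query} facts
          ; g-con = λ a p c t → ⊥-elim (TermAt-con-absurd t)
          ; h-nonempty = nonempty
          ; con-dom = λ { c (inj₁ (a , p , t)) → ⊥-elim (TermAt-con-absurd t)
                        ; c (inj₂ (inj₁ (_ , inj₁ ()))) ; c (inj₂ (inj₁ (_ , inj₂ ())))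
                        ; c (inj₂ (inj₂ (_ , _ , inj₁ ()))) ; c (inj₂ (inj₂ (_ , _ , inj₂ ()))) }
          ; neq-disjoint = λ u u′ ()
          ; sim-witness = λ s u u′ () }

        tid-hSet : ∀ (a : Fin 2) → hSet query g (var (toℕ a)) (tidc (tidOf (facts a)))
        tid-hSet fzero        = (f , f∈ , inj₁ refl) , λ { a p t → tid0 (TermAt⇒Loc t) }
          where
            tid0 : ∀ {a p} → Loc a p 0 → g a p (tidc (tidOf f))
            tid0 tid₀ = refl
        tid-hSet (fsuc fzero) = (f′ , f′∈ , inj₁ refl) , λ { a p t → tid1 (TermAt⇒Loc t) }
          where
            tid1 : ∀ {a p} → Loc a p 1 → g a p (tidc (tidOf f′))
            tid1 tid₁ = refl

      sameConstant-Ans : Ans (withTyping allValues) D E W query 0 1 (tidc (tidOf f)) (tidc (tidOf f′))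
      sameConstant-Ans = Satisfaction⇒Ans query 0 1 refl (∉InSim 0) (∉InSim 1) (λ ()) satisfaction
                           (tid-hSet fzero) (tid-hSet (fsuc fzero))

    CellReaches : Rel₀ Cell → ℕ → Fin (nrel Sg) → ℕ → Const → Set
    CellReaches W t R₀ k c =
      ∃[ f ] (f ∈ D × tidOf f ≡ t × rel f ≡ R₀
              × ∃[ t′ ] ∃[ i′ ] (W (t , suc k) (t′ , i′) × ValAt D t′ i′ c))

    module _ (R : Fin (nrel Sg)) (i : Fin (arity Sg R)) (R′ : Fin (nrel Sg)) (i′ : Fin (arity Sg R′)) where
      open SameConstant R i R′ i′

      private
        shared₀ : TermAt query fzero (suc (toℕ i)) (var 2)
        shared₀ = i , refl , ≡.trans (Vec.lookup∘tabulate _ i) (argTerm-self i offset₀)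
        shared₁ : TermAt query (fsuc fzero) (suc (toℕ i′)) (var 2)
        shared₁ = i′ , refl , ≡.trans (Vec.lookup∘tabulate _ i′) (argTerm-self i′ offset₁)

      Ans-sameConstant⁻ : ∀ {E W t t′} → Ans (withTyping allValues) D E W query 0 1 (tidc t) (tidc t′) →
        ∃[ c ] (CellReaches W t R (toℕ i) c × CellReaches W t′ R′ (toℕ i′) c)
      Ans-sameConstant⁻ {E} {W} ans
        with Ans⇒Satisfaction {allValues} {E} {W} query 0 1 refl (∉InSim 0) (∉InSim 1) ans
               (inj₁ (fzero , 0 , refl)) (inj₁ (fsuc fzero , 0 , refl))
      ... | s , h₀ , h₁ with Satisfaction.h-nonempty s 2 (inj₁ (fzero , suc (toℕ i) , shared₀))
      ... | c , _ , all = c , reaches fzero i h₀ shared₀ , reaches (fsuc fzero) i′ h₁ shared₁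
        where
          open Satisfaction s
          tid-at : ∀ a → TermAt query a 0 (var (toℕ a))
          tid-at fzero        = refl
          tid-at (fsuc fzero) = refl
          reaches : ∀ a (k : Fin (arity Sg (arel (atoms query a)))) {u} →
            hSet query g (var (toℕ a)) (tidc u) → TermAt query a (suc (toℕ k)) (var 2) →
            CellReaches W u (arel (atoms query a)) (toℕ k) c
          reaches a k (_ , hall) tk with reindex (atomFact-rel a) k
          ... | k′ , e with proj₁ (g-tid a _) (hall a 0 (tid-at a))
          ... | refl with proj₁ (g-cell a k′ c) (subst (λ m → g a (suc m) c) (≡.sym e) (all a (suc (toℕ k)) tk))
          ... | t′ , i′ , w , va =
            atomFact a , atomFact∈D a , refl , atomFact-rel a , t′ , i′
            , subst (λ m → W (tidOf (atomFact a) , suc m) (t′ , i′)) e w , va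

module Translation (Sim : Set) (⟦_⟧ : Sim → Const → Const → Set) (S : Schema) where
  open ER Sim ⟦_⟧
  open Queries Sim ⟦_⟧ (sig S)

  Sg : Signature
  Sg = sig S

  VS : Schema
  VS = valSchema S

  module ObjectRule (r : ORule Sg) (wf : WFORule S r) where
    q : Query Sg
    q = obody r

    noNeq : neq q ≡ []
    noNeq = proj₁ wf

    x y : ℕ
    x = ox r
    y = oy r

    a : Fin (nr q)
    a = proj₁ (proj₁ (proj₁ (proj₂ wf)))
    pa : ℕ
    pa = proj₁ (proj₂ (proj₁ (proj₁ (proj₂ wf))))
    x-at : TermAt q a pa (var x)
    x-at = proj₂ (proj₂ (proj₁ (proj₁ (proj₂ wf))))
    x-obj : ∀ a′ p → TermAt q a′ p (var x) → ObjPos S (arel (atoms q a′)) p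
    x-obj = proj₁ (proj₂ (proj₁ (proj₂ wf)))
    x∉sim : ¬ InSim q (var x)
    x∉sim = proj₂ (proj₂ (proj₁ (proj₂ wf)))

    b : Fin (nr q)
    b = proj₁ (proj₁ (proj₂ (proj₂ wf)))
    pb : ℕ
    pb = proj₁ (proj₂ (proj₁ (proj₂ (proj₂ wf))))
    y-at : TermAt q b pb (var y)
    y-at = proj₂ (proj₂ (proj₁ (proj₂ (proj₂ wf))))
    y-obj : ∀ a′ p → TermAt q a′ p (var y) → ObjPos S (arel (atoms q a′)) p
    y-obj = proj₁ (proj₂ (proj₂ (proj₂ wf)))
    y∉sim : ¬ InSim q (var y)
    y∉sim = proj₂ (proj₂ (proj₂ (proj₂ wf)))

    xt yt : ℕ
    xt = fresh q
    yt = suc (fresh q)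

    xt∉q : ¬ OccursQ q (var xt)
    xt∉q = fresh-∉ q ℕ.≤-refl
    yt∉q : ¬ OccursQ q (var yt)
    yt∉q = fresh-∉ q (ℕ.n≤1+n _)
    xt≢yt : ¬ xt ≡ yt
    xt≢yt = ℕ.<⇒≢ ℕ.≤-refl

    open TidCopies q a b xt yt public

    xt∉sim : ¬ InSim q⁺ (var xt)
    xt∉sim i = xt∉q (inj₂ (inj₂ i))
    yt∉sim : ¬ InSim q⁺ (var yt)
    yt∉sim i = yt∉q (inj₂ (inj₂ i))

    x-at⁺ : TermAt q⁺ fzero pa (var x)
    x-at⁺ with x-obj a pa x-at
    ... | _ , refl , _ = x-at
    y-at⁺ : TermAt q⁺ (fsuc fzero) pb (var y)
    y-at⁺ with y-obj b pb y-at
    ... | _ , refl , _ = y-at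

    valueRule : VRule Sg
    valueRule = record { vhard = ohard r ; vbody = q⁺ ; vx = xt ; vy = yt ; vi = pa ; vj = pb }

    valueRule-wf : WFVRule VS valueRule
    valueRule-wf =
        noNeq
      , (fzero , refl , (proj₁ (x-obj a pa x-at) , proj₁ (proj₂ (x-obj a pa x-at)) , refl) , xt-once , xt∉sim)
      , (fsuc fzero , refl , (proj₁ (y-obj b pb y-at) , proj₁ (proj₂ (y-obj b pb y-at)) , refl) , yt-once , yt∉sim)
      where
        xt-once : ∀ a′ p → TermAt q⁺ a′ p (var xt) → a′ ≡ fzero × p ≡ 0
        xt-once a′ p t with TermAt-copies⁻ t
        ... | inj₁ t₀                   = ⊥-elim (xt∉q (inj₁ (_ , p , t₀)))
        ... | inj₂ (inj₁ (e₁ , e₂ , _)) = e₁ , e₂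
        ... | inj₂ (inj₂ (_ , _ , e))   = ⊥-elim (xt≢yt (var-injective e))
        yt-once : ∀ a′ p → TermAt q⁺ a′ p (var yt) → a′ ≡ fsuc fzero × p ≡ 0
        yt-once a′ p t with TermAt-copies⁻ t
        ... | inj₁ t₀                   = ⊥-elim (yt∉q (inj₁ (_ , p , t₀)))
        ... | inj₂ (inj₁ (_ , _ , e))   = ⊥-elim (xt≢yt (≡.sym (var-injective e)))
        ... | inj₂ (inj₂ (e₁ , e₂ , _)) = e₁ , e₂

  sameConstantRule : (R : Fin (nrel Sg)) → Fin (arity Sg R) → (R′ : Fin (nrel Sg)) → Fin (arity Sg R′) → VRule Sg
  sameConstantRule R i R′ i′ = record
    { vhard = true ; vbody = SameConstant.query R i R′ i′ ; vx = 0 ; vy = 1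
    ; vi = suc (toℕ i) ; vj = suc (toℕ i′) }

  sameConstantRule-wf : ∀ R i R′ i′ → WFVRule VS (sameConstantRule R i R′ i′)
  sameConstantRule-wf R i R′ i′ =
    refl , (fzero , refl , (i , refl , refl) , once₀ , ∉InSim 0)
         , (fsuc fzero , refl , (i′ , refl , refl) , once₁ , ∉InSim 1)
    where
      open SameConstant R i R′ i′
      once₀ : ∀ a p → TermAt query a p (var 0) → a ≡ fzero × p ≡ 0
      once₀ a p t with TermAt⇒Loc t
      ... | tid₀ = refl , refl
      once₁ : ∀ a p → TermAt query a p (var 1) → a ≡ fsuc fzero × p ≡ 0
      once₁ a p t with TermAt⇒Loc t
      ... | tid₁ = refl , refl

  Position : Set
  Position = Σ (Fin (nrel Sg)) (λ R → Fin (arity Sg R))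

  IsObjectPosition : Position → Set
  IsObjectPosition (R , i) = type S R i ≡ tyO

  isObjectPosition? : ∀ p → Dec (IsObjectPosition p)
  isObjectPosition? (R , i) with type S R i
  ... | tyO = yes refl
  ... | tyV = no λ ()

  allPositions : List Position
  allPositions = List.concatMap (λ R → List.map (R ,_) (List.allFin (arity Sg R))) (List.allFin (nrel Sg))

  ∈-allPositions : ∀ R i → (R , i) ∈ allPositions
  ∈-allPositions R i = ∈.∈-concatMap⁺ (λ R → List.map (R ,_) (List.allFin (arity Sg R)))
    (Any.map (λ { refl → ∈.∈-map⁺ (R ,_) (∈.∈-allFin i) }) (∈.∈-allFin R))

  objectPositions : List Position
  objectPositions = List.filter isObjectPosition? allPositions

  ∈-objectPositions⁺ : ∀ {R i} → type S R i ≡ tyO → (R , i) ∈ objectPositions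
  ∈-objectPositions⁺ {R} {i} = ∈.∈-filter⁺ isObjectPosition? {xs = allPositions} (∈-allPositions R i)

  ∈-objectPositions⁻ : ∀ {p} → p ∈ objectPositions → IsObjectPosition p
  ∈-objectPositions⁻ p∈ = proj₂ (∈.∈-filter⁻ isObjectPosition? {xs = allPositions} p∈)

  sameConstantRules : List (VRule Sg)
  sameConstantRules =
    List.map (λ { ((R , i) , (R′ , i′)) → sameConstantRule R i R′ i′ })
             (List.cartesianProduct objectPositions objectPositions)

  ∈-sameConstantRules⁺ : ∀ {R i R′ i′} → type S R i ≡ tyO → type S R′ i′ ≡ tyO →
                         sameConstantRule R i R′ i′ ∈ sameConstantRules
  ∈-sameConstantRules⁺ o o′ =
    ∈.∈-map⁺ _ (∈.∈-cartesianProduct⁺ (∈-objectPositions⁺ o) (∈-objectPositions⁺ o′))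

  ∈-sameConstantRules⁻ : ∀ {r} → r ∈ sameConstantRules →
    ∃[ R ] ∃[ i ] ∃[ R′ ] ∃[ i′ ]
      (type S R i ≡ tyO × type S R′ i′ ≡ tyO × r ≡ sameConstantRule R i R′ i′)
  ∈-sameConstantRules⁻ r∈ with ∈.∈-map⁻ _ r∈
  ... | ((R , i) , (R′ , i′)) , m , refl with ∈.∈-cartesianProduct⁻ objectPositions objectPositions m
  ... | m₁ , m₂ = R , i , R′ , i′ , ∈-objectPositions⁻ m₁ , ∈-objectPositions⁻ m₂ , refl

  WFVRule-valSchema : ∀ {r} → WFVRule S r → WFVRule VS r
  WFVRule-valSchema (noNeq , (a , u , (j , e , _) , once , ∉sim) , (b , u′ , (j′ , e′ , _) , once′ , ∉sim′)) =
    noNeq , (a , u , (j , e , refl) , once , ∉sim) , (b , u′ , (j′ , e′ , refl) , once′ , ∉sim′)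

  module Translated (Sp : Spec Sg) (wf : WFSpec S Sp) where

    objectRule-wf : ∀ {r} → r ∈ ΓO Sp → WFORule S r
    objectRule-wf = All.lookup (proj₁ wf)

    valueRule-wf : ∀ {r} → r ∈ ΓV Sp → WFVRule S r
    valueRule-wf = All.lookup (proj₁ (proj₂ wf))

    translatedRule : ∀ {r} → r ∈ ΓO Sp → VRule Sg
    translatedRule {r} r∈ = ObjectRule.valueRule r (objectRule-wf r∈)

    translatedRules : List (VRule Sg)
    translatedRules = mapWith∈ (ΓO Sp) translatedRule

    translate : Spec Sg
    translate = record { ΓO = [] ; ΓV = ΓV Sp ++ (translatedRules ++ sameConstantRules) ; Δ = Δ Sp }

    translate-wf : WFSpec VS translate
    translate-wf =
        []
      , All.++⁺ (All.map (λ {r} → WFVRule-valSchema {r}) (proj₁ (proj₂ wf)))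
          (All.++⁺ (All.tabulate translated-wf) (All.tabulate sameConstant-wf))
      , proj₂ (proj₂ wf)
      where
        translated-wf : ∀ {r} → r ∈ translatedRules → WFVRule VS r
        translated-wf r∈ with ∈-mapWith∈⁻ _ r∈
        ... | r₀ , r₀∈ , refl = ObjectRule.valueRule-wf r₀ (objectRule-wf r₀∈)
        sameConstant-wf : ∀ {r} → r ∈ sameConstantRules → WFVRule VS r
        sameConstant-wf r∈ with ∈-sameConstantRules⁻ r∈
        ... | R , i , R′ , i′ , _ , _ , refl = sameConstantRule-wf R i R′ i′

    data RuleOrigin : VRule Sg → Set where
      value        : ∀ {r} → r ∈ ΓV Sp → RuleOrigin r
      object       : ∀ {r} (r∈ : r ∈ ΓO Sp) → RuleOrigin (translatedRule r∈)
      sameConstant : ∀ {R i R′ i′} → type S R i ≡ tyO → type S R′ i′ ≡ tyO →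
                     RuleOrigin (sameConstantRule R i R′ i′)

    ruleOrigin : ∀ {r} → r ∈ ΓV translate → RuleOrigin r
    ruleOrigin r∈ with ∈.∈-++⁻ (ΓV Sp) r∈
    ... | inj₁ r∈V = value r∈V
    ... | inj₂ r∈′ with ∈.∈-++⁻ translatedRules r∈′
    ... | inj₁ r∈T with ∈-mapWith∈⁻ _ r∈T
    ...   | _ , r₀∈ , refl = object r₀∈
    ruleOrigin r∈ | inj₂ _ | inj₂ r∈C with ∈-sameConstantRules⁻ r∈C
    ...   | _ , _ , _ , _ , o , o′ , refl = sameConstant o o′

    ∈-translate-value : ∀ {r} → r ∈ ΓV Sp → r ∈ ΓV translate
    ∈-translate-value = ∈.∈-++⁺ˡ

    ∈-translate-object : ∀ {r} (r∈ : r ∈ ΓO Sp) → translatedRule r∈ ∈ ΓV translate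
    ∈-translate-object r∈ = ∈.∈-++⁺ʳ (ΓV Sp) (∈.∈-++⁺ˡ (∈-mapWith∈⁺ _ r∈))

    ∈-translate-sameConstant : ∀ {R i R′ i′} → type S R i ≡ tyO → type S R′ i′ ≡ tyO →
                               sameConstantRule R i R′ i′ ∈ ΓV translate
    ∈-translate-sameConstant o o′ =
      ∈.∈-++⁺ʳ (ΓV Sp) (∈.∈-++⁺ʳ translatedRules (∈-sameConstantRules⁺ o o′))

module Correspondence (Sim : Set) (⟦_⟧ : Sim → Const → Const → Set) (S : Schema)
                      (D : Database (sig S)) (wt : WellTyped S D) (ut : UniqueTids D) where
  open ER Sim ⟦_⟧
  open Queries Sim ⟦_⟧ (sig S)
  open Semantics D
  open Translation Sim ⟦_⟧ S

  ObjS : Const → Set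
  ObjS = Obj S D

  CellsS CellsV : Cell → Set
  CellsS = Cells S D
  CellsV = Cells VS D

  _↦_ : Cell → Const → Set
  (t , i) ↦ a = ValAt D t i a

  _↦[_]_ : Cell → Rel₀ Const → Const → Set
  c ↦[ E ] o = ∃[ a ] (c ↦ a × E a o)

  same-position : ∀ {f f′} {j : Fin (arity Sg (rel f))} {j′ : Fin (arity Sg (rel f′))} → f ∈ D → f′ ∈ D →
    tidOf f ≡ tidOf f′ → suc (toℕ j) ≡ suc (toℕ j′) → Σ (f ≡ f′) (λ { refl → j ≡ j′ })
  same-position f∈ f′∈ t≡t′ i≡i′ with ut _ _ f∈ f′∈ t≡t′
  ... | refl = refl , Fin.toℕ-injective (ℕ.suc-injective i≡i′)

  ValAt-functional : ∀ {c a b} → c ↦ a → c ↦ b → a ≡ b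
  ValAt-functional (f , f∈ , tf , j , ij , la) (f′ , f′∈ , tf′ , j′ , ij′ , lb)
    with same-position f∈ f′∈ (≡.trans tf (≡.sym tf′)) (≡.trans ij (≡.sym ij′))
  ... | refl , refl = ≡.trans (≡.sym la) lb

  Cells⇒type : ∀ {f} → f ∈ D → ∀ j → CellsS (tidOf f , suc (toℕ j)) → type S (rel f) j ≡ tyV
  Cells⇒type f∈ j (f′ , f′∈ , tf′ , j′ , ij′ , ty) with same-position f′∈ f∈ tf′ ij′
  ... | refl , refl = ty

  Obj⇒obj : ∀ {a} → ObjS a → ∃[ n ] (a ≡ obj n)
  Obj⇒obj (f , f∈ , j , ty , la) with subst (λ T → HasTy T (lookup (args f) j)) ty (wt f f∈ j)
  ... | n , eq = n , ≡.trans (≡.sym la) eq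

  Cells↦val : ∀ {c a} → CellsS c → c ↦ a → ∃[ n ] (a ≡ val n)
  Cells↦val (f , f∈ , refl , j , refl , ty) (f′ , f′∈ , tf′ , j′ , ij′ , la)
    with same-position f′∈ f∈ tf′ ij′
  ... | refl , refl with subst (λ T → HasTy T (lookup (args f) j)) ty (wt f f∈ j)
  ... | n , eq = n , ≡.trans (≡.sym la) eq

  Obj↦⇒¬Cells : ∀ {c a} → ObjS a → c ↦ a → ¬ CellsS c
  Obj↦⇒¬Cells o va cs with Obj⇒obj o | Cells↦val cs va
  ... | _ , refl | _ , ()

  Obj⇒↦ : ∀ {a} → ObjS a → ∃[ c ] (c ↦ a)
  Obj⇒↦ (f , f∈ , j , _ , la) = (tidOf f , suc (toℕ j)) , f , f∈ , refl , j , refl , la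

  CellsS⇒CellsV : ∀ {c} → CellsS c → CellsV c
  CellsS⇒CellsV (f , f∈ , tf , j , ij , _) = f , f∈ , tf , j , ij , refl

  CellsV-split : ∀ {c} → CellsV c → CellsS c ⊎ ∃[ a ] (c ↦ a × ObjS a)
  CellsV-split (f , f∈ , tf , j , ij , _) with type S (rel f) j in eq
  ... | tyV = inj₁ (f , f∈ , tf , j , ij , eq)
  ... | tyO = inj₂ (lookup (args f) j , (f , f∈ , tf , j , ij , refl) , (f , f∈ , j , eq , refl))

  Obj⇒objectType : ∀ {f a} → f ∈ D → ∀ j → ObjS a → lookup (args f) j ≡ a → type S (rel f) j ≡ tyO
  Obj⇒objectType {f} f∈ j oa la with type S (rel f) j in eq
  ... | tyO = refl
  ... | tyV = ⊥-elim (Obj↦⇒¬Cells oa (f , f∈ , refl , j , refl , la) (f , f∈ , refl , j , refl , eq))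

  merge : Rel₀ Const → Rel₀ Cell → Rel₀ Cell
  merge E V = V ∪₂ VE D E

  merge-resp-≐ : ∀ {E E′ V V′} → E ≐ E′ → V ≐ V′ → merge E V ⇒ merge E′ V′
  merge-resp-≐ E≐E′ V≐V′ (inj₁ v)                    = inj₁ (proj₁ (V≐V′ _ _) v)
  merge-resp-≐ E≐E′ V≐V′ (inj₂ (a , b , va , vb , e)) = inj₂ (a , b , va , vb , proj₁ (E≐E′ a b) e)

  module _ {E : Rel₀ Const} {V : Rel₀ Cell} (isE : IsEquivalenceOn ObjS E) (isV : IsEquivalenceOn CellsS V) where
    private
      module E = IsEquivalenceOn isE
      module V = IsEquivalenceOn isV

    merge-isEquivalenceOn : IsEquivalenceOn CellsV (merge E V)
    merge-isEquivalenceOn = record { refl-on = refl-on ; sym = sym ; trans = trans ; support = support }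
      where
        refl-on : ∀ {c} → CellsV c → merge E V c c
        refl-on cv with CellsV-split cv
        ... | inj₁ cs              = inj₁ (V.refl-on cs)
        ... | inj₂ (a , va , oa)   = inj₂ (a , a , va , va , E.refl-on oa)
        sym : ∀ {c d} → merge E V c d → merge E V d c
        sym (inj₁ v)                    = inj₁ (V.sym v)
        sym (inj₂ (a , b , va , vb , e)) = inj₂ (b , a , vb , va , E.sym e)
        -- V-pairs live on value positions and VE-pairs on object positions, so they never chain.
        trans : ∀ {c d e} → merge E V c d → merge E V d e → merge E V c e
        trans (inj₁ v) (inj₁ v′) = inj₁ (V.trans v v′)
        trans (inj₁ v) (inj₂ (a , _ , va , _ , e)) =
          ⊥-elim (Obj↦⇒¬Cells (proj₁ (E.support e)) va (proj₂ (V.support v)))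
        trans (inj₂ (_ , b , _ , vb , e)) (inj₁ v) =
          ⊥-elim (Obj↦⇒¬Cells (proj₂ (E.support e)) vb (proj₁ (V.support v)))
        trans (inj₂ (a , b , va , vb , e)) (inj₂ (a′ , b′ , va′ , vb′ , e′)) =
          inj₂ (a , b′ , va , vb′ , E.trans e (subst (λ z → E z b′) (≡.sym (ValAt-functional vb va′)) e′))
        support : ∀ {c d} → merge E V c d → CellsV c × CellsV d
        support (inj₁ v) = CellsS⇒CellsV (proj₁ (V.support v)) , CellsS⇒CellsV (proj₂ (V.support v))
        support (inj₂ (_ , _ , va , vb , _)) = ValAt⇒Cells va , ValAt⇒Cells vb

    cellSet-merge : ∀ {E′} f → f ∈ D → ∀ j c →
      cellSet S D E V f j c iff cellSet VS D E′ (merge E V) f j c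
    cellSet-merge {E′} f f∈ j c with type S (rel f) j in eq
    ... | tyV = (λ { (t′ , i′ , v , va) → t′ , i′ , inj₁ v , va }) , back
      where
        back : cellSet VS D E′ (merge E V) f j c →
               ∃[ t′ ] ∃[ i′ ] (V (tidOf f , suc (toℕ j)) (t′ , i′) × ValAt D t′ i′ c)
        back (t′ , i′ , inj₁ v , va) = t′ , i′ , v , va
        back (_ , _ , inj₂ (_ , _ , va₁ , _ , e) , _) =
          ⊥-elim (Obj↦⇒¬Cells (proj₁ (E.support e)) va₁ (f , f∈ , refl , j , refl , eq))
    ... | tyO = forth , back
      where
        forth : E (lookup (args f) j) c → cellSet VS D E′ (merge E V) f j c
        forth e with Obj⇒↦ (proj₂ (E.support e))
        ... | (t′ , i′) , vc = t′ , i′ , inj₂ (lookup (args f) j , c , ValAt-self f∈ j , vc , e) , vc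
        back : cellSet VS D E′ (merge E V) f j c → E (lookup (args f) j) c
        back (_ , _ , inj₁ v , _) with ≡.trans (≡.sym eq) (Cells⇒type f∈ j (proj₁ (V.support v)))
        ... | ()
        back (_ , _ , inj₂ (a , b , va₁ , vb , e) , va) =
          subst (λ z → E z c) (ValAt-functional va₁ (ValAt-self f∈ j)) (subst (E a) (ValAt-functional vb va) e)

    Satisfaction-merge⁺ : ∀ {E′ q} → Satisfaction (type S) E V q → Satisfaction allValues E′ (merge E V) q
    Satisfaction-merge⁺ {E′} = Satisfaction-transfer (λ f f∈ j c → proj₁ (cellSet-merge {E′} f f∈ j c))
                                                     (λ f f∈ j c → proj₂ (cellSet-merge {E′} f f∈ j c))

    Satisfaction-merge⁻ : ∀ {E′ q} → Satisfaction allValues E′ (merge E V) q → Satisfaction (type S) E V q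
    Satisfaction-merge⁻ {E′} = Satisfaction-transfer (λ f f∈ j c → proj₂ (cellSet-merge {E′} f f∈ j c))
                                                     (λ f f∈ j c → proj₁ (cellSet-merge {E′} f f∈ j c))

    Sat-merge⁺ : ∀ {E′ q} → Sat S D E V q → Sat VS D E′ (merge E V) q
    Sat-merge⁺ {E′} {q} sat = Satisfaction⇒Sat (Satisfaction-merge⁺ {E′} {q} (Sat⇒Satisfaction sat))

    Sat-merge⁻ : ∀ {E′ q} → Sat VS D E′ (merge E V) q → Sat S D E V q
    Sat-merge⁻ {E′} {q} sat = Satisfaction⇒Sat (Satisfaction-merge⁻ {E′} {q} (Sat⇒Satisfaction sat))

    Ans-merge⁻ : ∀ {E′ W q x y c c′} → W ⇒ merge E V → neq q ≡ [] →
      Ans VS D E′ W q x y c c′ → Ans S D E V q x y c c′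
    Ans-merge⁻ {E′} {W} {q} {x} {y} {c} {c′} W⊆ noNeq (x≡y , sat) =
      x≡y , Satisfaction⇒Sat (Satisfaction-merge⁻ {E′}
                (Satisfaction-mono grow (Sat⇒Satisfaction {allValues} {E′} {W} sat) noNeq′))
      where
        grow : CellSets⊆ allValues E′ W allValues E′ (merge E V)
        grow f f∈ j c (t′ , i′ , w , va) = t′ , i′ , W⊆ w , va
        noNeq′ : neq (substQ y c′ (substQ x c q)) ≡ []
        noNeq′ = Substitution.neq-substQ y c′ {substQ x c q} (Substitution.neq-substQ x c {q} noNeq)

    merge-objectCells : ∀ {c d o o′} → c ↦[ E ] o → d ↦[ E ] o′ → merge E V c d → E o o′
    merge-objectCells (_ , vc , e₁) _ (inj₁ v) =
      ⊥-elim (Obj↦⇒¬Cells (proj₁ (E.support e₁)) vc (proj₁ (V.support v)))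
    merge-objectCells {o = o} (a , vc , e₁) (b , vd , e₂) (inj₂ (a′ , b′ , vc′ , vd′ , e)) =
      E.trans (E.sym e₁)
        (E.trans (subst (E a) (ValAt-functional vd′ vd) (subst (λ z → E z b′) (ValAt-functional vc′ vc) e)) e₂)

    merge-valueCell : ∀ {c d} → CellsS c → merge E V c d → V c d
    merge-valueCell cs (inj₁ v)                    = v
    merge-valueCell cs (inj₂ (_ , _ , va , _ , e)) = ⊥-elim (Obj↦⇒¬Cells (proj₁ (E.support e)) va cs)

  Sat-valSchema-resp-≐ : ∀ {E₁ E₂ W W′ q} → W ≐ W′ → Sat VS D E₁ W q → Sat VS D E₂ W′ q
  Sat-valSchema-resp-≐ {E₁} {E₂} {W} {W′} {q} W≐W′ =
    Sat-transfer {allValues} {E₁} {W} {allValues} {E₂} {W′} {q}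
      (λ { f f∈ j c (t′ , i′ , w , va) → t′ , i′ , proj₁ (W≐W′ _ _) w , va })
      (λ { f f∈ j c (t′ , i′ , w , va) → t′ , i′ , proj₂ (W≐W′ _ _) w , va })

  reindex-type : ∀ {R R′} (e : R ≡ R′) (j : Fin (arity Sg R′)) →
                 type S R (proj₁ (reindex e j)) ≡ type S R′ j
  reindex-type refl j = refl

  module _ {ty : Typing} {E : Rel₀ Const} {V : Rel₀ Cell} {q : Query Sg} (s : Satisfaction ty E V q) where
    open Satisfaction s

    tid-hSet : ∀ a {x t} → u0 (atoms q a) ≡ var x → hSet q g (var x) (tidc t) → tidOf (atomFact a) ≡ t
    tid-hSet a u h with proj₁ (g-tid a _) (proj₂ h a 0 u)
    ... | refl = refl

    ValPos⇒Cells : ∀ a {p} → ValPos S (arel (atoms q a)) p → CellsS (tidOf (atomFact a) , p)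
    ValPos⇒Cells a (j , refl , ty-j) =
      atomFact a , atomFact∈D a , refl , proj₁ (reindex (atomFact-rel a) j)
      , cong suc (proj₂ (reindex (atomFact-rel a) j)) , ≡.trans (reindex-type (atomFact-rel a) j) ty-j

  module _ {E : Rel₀ Const} {V : Rel₀ Cell} {q : Query Sg} (s : Satisfaction (type S) E V q) where
    open Satisfaction s

    ObjPos⇒↦ : ∀ a {p x o} → TermAt q a p (var x) → ObjPos S (arel (atoms q a)) p →
               hSet q g (var x) o → (tidOf (atomFact a) , p) ↦[ E ] o
    ObjPos⇒↦ a {o = o} t (j , refl , ty-j) (_ , all) =
      lookup (args (atomFact a)) j′
      , (atomFact a , atomFact∈D a , refl , j′ , cong suc (proj₂ (reindex (atomFact-rel a) j)) , refl)
      , subst (λ T → cellSetTy T D E V (atomFact a) j′ o)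
              (≡.trans (reindex-type (atomFact-rel a) j) ty-j)
              (proj₁ (g-cell a j′ o)
                (subst (λ k → g a (suc k) o) (≡.sym (proj₂ (reindex (atomFact-rel a) j))) (all a _ t)))
      where j′ = proj₁ (reindex (atomFact-rel a) j)

  Ans⇒Cells : ∀ {ty E V t t′} (r : VRule Sg) → WFVRule S r →
    Ans (withTyping ty) D E V (vbody r) (vx r) (vy r) (tidc t) (tidc t′) → CellsS (t , vi r) × CellsS (t′ , vj r)
  Ans⇒Cells r (noNeq , (a , ua , vpa , _ , x∉sim) , (b , ub , vpb , _ , y∉sim)) ans
    with Ans⇒Satisfaction (vbody r) (vx r) (vy r) noNeq x∉sim y∉sim ans (inj₁ (a , 0 , ua)) (inj₁ (b , 0 , ub))
  ... | s , hx , hy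
    rewrite ≡.sym (tid-hSet s a ua hx) | ≡.sym (tid-hSet s b ub hy) = ValPos⇒Cells s a vpa , ValPos⇒Cells s b vpb

  module ObjectRuleAnswers (r : ORule Sg) (wf : WFORule S r) where
    open ObjectRule r wf

    x∈q : OccursQ q (var x)
    x∈q = inj₁ (a , pa , x-at)
    y∈q : OccursQ q (var y)
    y∈q = inj₁ (b , pb , y-at)

    Ans-valueRule⁺ : ∀ {E V E′ o o′} → IsEquivalenceOn ObjS E → IsEquivalenceOn CellsS V →
      Ans S D E V q x y o o′ →
      ∃[ t ] ∃[ t′ ] ((t , pa) ↦[ E ] o × (t′ , pb) ↦[ E ] o′
                      × Ans VS D E′ (merge E V) q⁺ xt yt (tidc t) (tidc t′))
    Ans-valueRule⁺ {E} {V} {E′} isE isV ans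
      with Ans⇒Satisfaction {type S} {E} {V} q x y noNeq x∉sim y∉sim ans x∈q y∈q
    ... | s , hx , hy =
      _ , _ , ObjPos⇒↦ s a x-at (x-obj a pa x-at) hx , ObjPos⇒↦ s b y-at (y-obj b pb y-at) hy
      , Satisfaction⇒Ans q⁺ xt yt noNeq xt∉sim yt∉sim (λ e → ⊥-elim (xt≢yt e))
          (Satisfaction-copies⁺ q a b xt yt xt∉q yt∉q xt≢yt sV)
          (hSet-xt q a b xt yt xt∉q yt∉q xt≢yt sV) (hSet-yt q a b xt yt xt∉q yt∉q xt≢yt sV)
      where
        sV : Satisfaction allValues E′ (merge E V) q
        sV = Satisfaction-merge⁺ isE isV s

    private
      pick-y : ∀ {ty E V} (s : Satisfaction ty E V q⁺) {o} → hSet q⁺ (Satisfaction.g s) (var x) o →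
               ∃[ o′ ] (hSet q⁺ (Satisfaction.g s) (var y) o′ × (x ≡ y → o ≡ o′))
      pick-y s {o} hx with x ≟ y
      ... | yes refl = o , hx , λ _ → refl
      ... | no x≢y   = let (o′ , hy) = Satisfaction.h-nonempty s y (OccursQ-copies⁺ y∈q)
                       in o′ , hy , λ e → ⊥-elim (x≢y e)

    private
      answer-from-copies : ∀ {E V t t′} (s : Satisfaction (type S) E V q⁺) →
        hSet q⁺ (Satisfaction.g s) (var xt) (tidc t) → hSet q⁺ (Satisfaction.g s) (var yt) (tidc t′) →
        ∃[ o ] ∃[ o′ ] (Ans S D E V q x y o o′ × (t , pa) ↦[ E ] o × (t′ , pb) ↦[ E ] o′)
      answer-from-copies s hxt hyt with Satisfaction.h-nonempty s x (OccursQ-copies⁺ x∈q)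
      ... | o , hx with pick-y s hx
      ... | o′ , hy , x≡y⇒o≡o′
        rewrite ≡.sym (tid-hSet s fzero refl hxt) | ≡.sym (tid-hSet s (fsuc fzero) refl hyt) =
        o , o′
        , Satisfaction⇒Ans q x y noNeq x∉sim y∉sim x≡y⇒o≡o′ (Satisfaction-copies⁻ q a b xt yt noNeq s)
            (hSet-copies⁻ q a b xt yt {Satisfaction.g s} (var x) hx)
            (hSet-copies⁻ q a b xt yt {Satisfaction.g s} (var y) hy)
        , ObjPos⇒↦ s fzero x-at⁺ (x-obj a pa x-at) hx
        , ObjPos⇒↦ s (fsuc fzero) y-at⁺ (y-obj b pb y-at) hy

    Ans-valueRule⁻ : ∀ {E V E′ W t t′} → IsEquivalenceOn ObjS E → IsEquivalenceOn CellsS V →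
      W ⇒ merge E V → Ans VS D E′ W q⁺ xt yt (tidc t) (tidc t′) →
      ∃[ o ] ∃[ o′ ] (Ans S D E V q x y o o′ × (t , pa) ↦[ E ] o × (t′ , pb) ↦[ E ] o′)
    Ans-valueRule⁻ {E} {V} {E′} {W} isE isV W⊆ ans
      with Ans⇒Satisfaction {allValues} {E′} {W} q⁺ xt yt noNeq xt∉sim yt∉sim ans
             (inj₁ (fzero , 0 , refl)) (inj₁ (fsuc fzero , 0 , refl))
    ... | s , hxt , hyt =
      answer-from-copies (Satisfaction-merge⁻ isE isV {E′} (Satisfaction-mono grow s noNeq))
        (hSet-mono grow s (var xt) hxt) (hSet-mono grow s (var yt) hyt)
      where
        grow : CellSets⊆ allValues E′ W allValues E′ (merge E V)
        grow f f∈ j c (t′ , i′ , w , va) = t′ , i′ , W⊆ w , va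

module Simulation (Sim : Set) (⟦_⟧ : Sim → Const → Const → Set) (S : Schema)
                  (Sp : ER.Spec Sim ⟦_⟧ (sig S)) (wf : ER.WFSpec Sim ⟦_⟧ S Sp)
                  (D : Database (sig S)) (wt : WellTyped S D) (ut : UniqueTids D) where
  open ER Sim ⟦_⟧
  open Queries Sim ⟦_⟧ (sig S)
  open Semantics D
  open Translation Sim ⟦_⟧ S
  open Correspondence Sim ⟦_⟧ S D wt ut

  open Translated Sp wf

  Sp′ : Spec Sg
  Sp′ = translate

  Cand⇒isEquivalenceOn : ∀ {E V} → Cand S D Sp E V → IsEquivalenceOn ObjS E × IsEquivalenceOn CellsS V
  Cand⇒isEquivalenceOn init              = EqRel-isEquivalenceOn , EqRel-isEquivalenceOn
  Cand⇒isEquivalenceOn (stepO c _ _ _ _ _) = EqRel-isEquivalenceOn , proj₂ (Cand⇒isEquivalenceOn c)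
  Cand⇒isEquivalenceOn (stepV c _ _ _ _ _) = proj₁ (Cand⇒isEquivalenceOn c) , EqRel-isEquivalenceOn

  Cand′⇒isEquivalenceOn : ∀ {E W} → Cand VS D Sp′ E W → IsEquivalenceOn CellsV W
  Cand′⇒isEquivalenceOn init                 = EqRel-isEquivalenceOn
  Cand′⇒isEquivalenceOn (stepO _ _ () _ _ _)
  Cand′⇒isEquivalenceOn (stepV _ _ _ _ _ _)  = EqRel-isEquivalenceOn

  noObjects : Rel₀ Const
  noObjects = EqRel emptyRel (Obj VS D)

  noObjects-empty : ∀ {a b} → ¬ noObjects a b
  noObjects-empty e with proj₁ (EqRel-support e)
  ... | _ , _ , _ , () , _

  Cand′-noObjects : ∀ {E W} → Cand VS D Sp′ E W → E ≡ noObjects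
  Cand′-noObjects init                 = refl
  Cand′-noObjects (stepO _ _ () _ _ _)
  Cand′-noObjects (stepV c _ _ _ _ _)  = Cand′-noObjects c

  SameObject : Rel₀ Cell
  SameObject c d = ∃[ a ] (c ↦ a × d ↦ a × ObjS a)

  Linked : Rel₀ Cell → Rel₀ Const
  Linked T a b = ObjS a × ObjS b × (∀ {c d} → c ↦ a → d ↦ b → T c d)

  Linked-mono : ∀ {T T′} → T ⇒ T′ → Linked T ⇒ Linked T′
  Linked-mono T⊆T′ (oa , ob , all) = oa , ob , λ vc vd → T⊆T′ (all vc vd)

  withSameObject : Rel₀ Cell → Rel₀ Cell
  withSameObject W = EqRel (W ∪₂ SameObject) CellsV

  withSameObject-mono : ∀ {W W′} → W ⇒ W′ → withSameObject W ⇒ withSameObject W′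
  withSameObject-mono W⊆W′ = EqRel-map (λ c → c) λ { (inj₁ w) → inj₁ (W⊆W′ w) ; (inj₂ s) → inj₂ s }

  ¬Cells-objectPosition : ∀ {f t R} {i : Fin (arity Sg R)} → f ∈ D → tidOf f ≡ t → rel f ≡ R →
                          type S R i ≡ tyO → ¬ CellsS (t , suc (toℕ i))
  ¬Cells-objectPosition f∈ refl refl ty cs with ≡.trans (≡.sym ty) (Cells⇒type f∈ _ cs)
  ... | ()

  module _ {E : Rel₀ Const} {V : Rel₀ Cell} (isE : IsEquivalenceOn ObjS E) (isV : IsEquivalenceOn CellsS V) where
    private
      module E = IsEquivalenceOn isE
      module V = IsEquivalenceOn isV

    merge-stepV : ∀ {W c₁ c₂} → W ⇒ merge E V → CellsS c₁ → CellsS c₂ →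
      EqRel (W ∪₂ single c₁ c₂) CellsV ⇒ merge E (EqRel (V ∪₂ single c₁ c₂) CellsS)
    merge-stepV {W} {c₁} {c₂} W⊆ cs₁ cs₂ = EqRel-least (merge-isEquivalenceOn isE EqRel-isEquivalenceOn) step
      where
        step : ∀ {c d} → CellsV c → CellsV d → (W ∪₂ single c₁ c₂) c d →
               merge E (EqRel (V ∪₂ single c₁ c₂) CellsS) c d
        step _ _ (inj₁ w) with W⊆ w
        ... | inj₁ v  = inj₁ (⊆-EqRel-∪₂ isV v)
        ... | inj₂ ve = inj₂ ve
        step _ _ (inj₂ (refl , refl)) = inj₁ (incl cs₁ cs₂ (inj₂ (refl , refl)))

    merge-stepO : ∀ {W c₁ c₂ o o′} → W ⇒ merge E V → c₁ ↦[ E ] o → c₂ ↦[ E ] o′ →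
      EqRel (W ∪₂ single c₁ c₂) CellsV ⇒ merge (EqRel (E ∪₂ single o o′) ObjS) V
    merge-stepO {W} {c₁} {c₂} {o} {o′} W⊆ (a₁ , va₁ , e₁) (a₂ , va₂ , e₂) =
      EqRel-least (merge-isEquivalenceOn EqRel-isEquivalenceOn isV) step
      where
        up : E ⇒ EqRel (E ∪₂ single o o′) ObjS
        up = ⊆-EqRel-∪₂ isE
        step : ∀ {c d} → CellsV c → CellsV d → (W ∪₂ single c₁ c₂) c d →
               merge (EqRel (E ∪₂ single o o′) ObjS) V c d
        step _ _ (inj₁ w) with W⊆ w
        ... | inj₁ v                      = inj₁ v
        ... | inj₂ (b₁ , b₂ , vb₁ , vb₂ , e) = inj₂ (b₁ , b₂ , vb₁ , vb₂ , up e)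
        step _ _ (inj₂ (refl , refl)) =
          inj₂ (a₁ , a₂ , va₁ , va₂
               , trans' (up e₁) (trans' (incl (proj₂ (E.support e₁)) (proj₂ (E.support e₂)) (inj₂ (refl , refl)))
                                        (sym' (up e₂))))

    Linked-stepO : ∀ {T c₁ c₂ o o′} → IsEquivalenceOn CellsV T → SameObject ⇒ T → E ⇒ Linked T →
      c₁ ↦[ E ] o → c₂ ↦[ E ] o′ → T c₁ c₂ → EqRel (E ∪₂ single o o′) ObjS ⇒ Linked T
    Linked-stepO {T} {o = o} {o′} isT same⊆T E⊆ (a₁ , va₁ , e₁) (a₂ , va₂ , e₂) t₁₂ =
      EqRel-least isLinked step
      where
        module T = IsEquivalenceOn isT
        isLinked : IsEquivalenceOn ObjS (Linked T)
        isLinked = record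
          { refl-on = λ oa → oa , oa , λ vc vd → same⊆T (_ , vc , vd , oa)
          ; sym     = λ (oa , ob , all) → ob , oa , λ vc vd → T.sym (all vd vc)
          ; trans   = λ { (oa , ob , all) (_ , oc , all′) →
                        let (_ , vb) = Obj⇒↦ ob in oa , oc , λ vc vd → T.trans (all vc vb) (all′ vb vd) }
          ; support = λ (oa , ob , _) → oa , ob }
        step : ∀ {a b} → ObjS a → ObjS b → (E ∪₂ single o o′) a b → Linked T a b
        step _ _ (inj₁ e) = E⊆ e
        step oa ob (inj₂ (refl , refl)) = oa , ob , λ vc vd →
          T.trans (T.sym (proj₂ (proj₂ (E⊆ e₁)) va₁ vc)) (T.trans t₁₂ (proj₂ (proj₂ (E⊆ e₂)) va₂ vd))

    sameConstant-VE : ∀ {W R R′ t t′ c} {i : Fin (arity Sg R)} {i′ : Fin (arity Sg R′)} → W ⇒ merge E V →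
      type S R i ≡ tyO → type S R′ i′ ≡ tyO →
      CellReaches W t R (toℕ i) c → CellReaches W t′ R′ (toℕ i′) c →
      VE D E (t , suc (toℕ i)) (t′ , suc (toℕ i′))
    sameConstant-VE W⊆ ty ty′ (f , f∈ , tf , rf , _ , _ , w , vc) (f′ , f′∈ , tf′ , rf′ , _ , _ , w′ , vc′)
      with W⊆ w | W⊆ w′
    ... | inj₁ v | _      = ⊥-elim (¬Cells-objectPosition f∈ tf rf ty (proj₁ (V.support v)))
    ... | inj₂ _ | inj₁ v = ⊥-elim (¬Cells-objectPosition f′∈ tf′ rf′ ty′ (proj₁ (V.support v)))
    ... | inj₂ (a , b , va , vb , e) | inj₂ (a′ , b′ , va′ , vb′ , e′) =
      a , a′ , va , va′ , E.trans (subst (E a) (ValAt-functional vb vc) e)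
                                  (E.sym (subst (E a′) (ValAt-functional vb′ vc′) e′))

  EqRel-stepV : ∀ {V W c₁ c₂} → V ⇒ W →
                EqRel (V ∪₂ single c₁ c₂) CellsS ⇒ EqRel (W ∪₂ single c₁ c₂) CellsV
  EqRel-stepV V⊆W = EqRel-map CellsS⇒CellsV λ { (inj₁ v) → inj₁ (V⊆W v) ; (inj₂ e) → inj₂ e }

  -- The invariant of the backward simulation: W is sandwiched by a candidate ⟨E , V⟩ of Σ.
  record Reflected (W : Rel₀ Cell) : Set₁ where
    constructor reflected
    field
      {E}      : Rel₀ Const
      {V}      : Rel₀ Cell
      cand     : Cand S D Sp E V
      W⊆merge  : W ⇒ merge E V
      V⊆W      : V ⇒ W
      E⊆linked : E ⇒ Linked (withSameObject W)

  module _ {Ev : Rel₀ Const} {W : Rel₀ Cell} {t t′ : ℕ} (cW : Cand VS D Sp′ Ev W) (inv : Reflected W) where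
    open Reflected inv
    private
      isE = proj₁ (Cand⇒isEquivalenceOn cand)
      isV = proj₂ (Cand⇒isEquivalenceOn cand)
      isW = Cand′⇒isEquivalenceOn cW

      grow : ∀ {c₁ c₂} → W ⇒ EqRel (W ∪₂ single c₁ c₂) CellsV
      grow = ⊆-EqRel-∪₂ isW

      E⊆′ : ∀ {c₁ c₂} → E ⇒ Linked (withSameObject (EqRel (W ∪₂ single c₁ c₂) CellsV))
      E⊆′ e = Linked-mono (withSameObject-mono grow) (E⊆linked e)

    Reflected-value : ∀ {r} → r ∈ ΓV Sp → Ans VS D Ev W (vbody r) (vx r) (vy r) (tidc t) (tidc t′) →
                      Reflected (EqRel (W ∪₂ single (t , vi r) (t′ , vj r)) CellsV)
    Reflected-value {r} r∈ ans =
      reflected (stepV cand r r∈ t t′ ansS) (merge-stepV isE isV W⊆merge cs cs′) (EqRel-stepV V⊆W) E⊆′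
      where
        ansS : Ans S D E V (vbody r) (vx r) (vy r) (tidc t) (tidc t′)
        ansS = Ans-merge⁻ isE isV {Ev} {W} {vbody r} W⊆merge (proj₁ (valueRule-wf r∈)) ans
        cs   = proj₁ (Ans⇒Cells r (valueRule-wf r∈) ansS)
        cs′  = proj₂ (Ans⇒Cells r (valueRule-wf r∈) ansS)

    Reflected-object : ∀ {r} (r∈ : r ∈ ΓO Sp) → let r′ = translatedRule r∈ in
      Ans VS D Ev W (vbody r′) (vx r′) (vy r′) (tidc t) (tidc t′) →
      Reflected (EqRel (W ∪₂ single (t , vi r′) (t′ , vj r′)) CellsV)
    Reflected-object {r} r∈ ans =
      reflect (ObjectRuleAnswers.Ans-valueRule⁻ r (objectRule-wf r∈) {E} {V} {Ev} {W} isE isV W⊆merge ans)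
      where
        open ObjectRule r (objectRule-wf r∈) using (pa; pb)
        cv : ∀ {c d} → SameObject c d → CellsV c
        cv (_ , vc , _ , _) = ValAt⇒Cells vc
        cv′ : ∀ {c d} → SameObject c d → CellsV d
        cv′ (_ , _ , vd , _) = ValAt⇒Cells vd
        reflect : ∃[ o ] ∃[ o′ ] (Ans S D E V (obody r) (ox r) (oy r) o o′
                                  × (t , pa) ↦[ E ] o × (t′ , pb) ↦[ E ] o′) →
                  Reflected (EqRel (W ∪₂ single (t , pa) (t′ , pb)) CellsV)
        reflect (o , o′ , ansS , ↦o@(_ , va₁ , _) , ↦o′@(_ , va₂ , _)) =
          reflected (stepO cand r r∈ o o′ ansS) (merge-stepO isE isV W⊆merge ↦o ↦o′) (λ v → grow (V⊆W v))
            λ e → Linked-stepO isE isV EqRel-isEquivalenceOn (λ s → incl (cv s) (cv′ s) (inj₂ s)) E⊆′ ↦o ↦o′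
                    (incl cv₁ cv₂ (inj₁ (incl cv₁ cv₂ (inj₂ (refl , refl))))) e
          where
            cv₁ = ValAt⇒Cells va₁
            cv₂ = ValAt⇒Cells va₂

    Reflected-sameConstant : ∀ {R i R′ i′} → type S R i ≡ tyO → type S R′ i′ ≡ tyO →
      Ans VS D Ev W (SameConstant.query R i R′ i′) 0 1 (tidc t) (tidc t′) →
      Reflected (EqRel (W ∪₂ single (t , suc (toℕ i)) (t′ , suc (toℕ i′))) CellsV)
    Reflected-sameConstant {R} {i} {R′} {i′} ty ty′ ans =
      reflected cand (EqRel-least (merge-isEquivalenceOn isE isV) step) (λ v → grow (V⊆W v)) E⊆′
      where
        ve : VE D E (t , suc (toℕ i)) (t′ , suc (toℕ i′))
        ve = let (c , reach , reach′) = Ans-sameConstant⁻ R i R′ i′ {Ev} {W} ans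
             in sameConstant-VE isE isV W⊆merge ty ty′ reach reach′
        step : ∀ {c d} → CellsV c → CellsV d →
               (W ∪₂ single (t , suc (toℕ i)) (t′ , suc (toℕ i′))) c d → merge E V c d
        step _ _ (inj₁ w)             = W⊆merge w
        step _ _ (inj₂ (refl , refl)) = inj₂ ve

  Cand′⇒Reflected : ∀ {Ev W} → Cand VS D Sp′ Ev W → Reflected W
  Cand′⇒Reflected init = reflected init W⊆ (EqRel-map CellsS⇒CellsV (λ ())) E⊆
    where
      E⊆ : EqRel emptyRel ObjS ⇒ Linked (withSameObject (EqRel emptyRel CellsV))
      E⊆ e with EqRel-emptyRel⇒≡ e
      ... | refl = let oa = proj₁ (EqRel-support e) in
        oa , oa , λ vc vd → incl (ValAt⇒Cells vc) (ValAt⇒Cells vd) (inj₂ (_ , vc , vd , oa))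
      W⊆ : EqRel emptyRel CellsV ⇒ merge (EqRel emptyRel ObjS) (EqRel emptyRel CellsS)
      W⊆ w with EqRel-emptyRel⇒≡ w
      ... | refl = IsEquivalenceOn.refl-on (merge-isEquivalenceOn EqRel-isEquivalenceOn EqRel-isEquivalenceOn)
                                           (proj₁ (EqRel-support w))
  Cand′⇒Reflected (stepO _ _ () _ _ _)
  Cand′⇒Reflected (stepV cW r r∈ t t′ ans) with ruleOrigin r∈
  ... | value r∈V          = Reflected-value cW (Cand′⇒Reflected cW) r∈V ans
  ... | object r∈O         = Reflected-object cW (Cand′⇒Reflected cW) r∈O ans
  ... | sameConstant ty ty′ = Reflected-sameConstant cW (Cand′⇒Reflected cW) ty ty′ ans

  Characterised : Rel₀ Const → Rel₀ Cell → Set₁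
  Characterised E′ V′ =
    ∃[ E ] ∃[ V ] (IsSol S D Sp E V × (∀ a b → ¬ E′ a b) × (∀ c d → V′ c d iff (V c d ⊎ VE D E c d)))

  module _ {E′ Ev : Rel₀ Const} {V′ W : Rel₀ Cell}
           (cW : Cand VS D Sp′ Ev W) (Ev≐E′ : Ev ≐ E′) (W≐V′ : W ≐ V′)
           (hard : SatHard VS D Sp′ E′ V′) (inv : Reflected W) where
    open Reflected inv
    private
      isE = proj₁ (Cand⇒isEquivalenceOn cand)
      isV = proj₂ (Cand⇒isEquivalenceOn cand)
      isW = Cand′⇒isEquivalenceOn cW

      hard-value : ∀ r → r ∈ ΓV Sp′ → vhard r ≡ true → ∀ t t′ →
        Ans VS D E′ V′ (vbody r) (vx r) (vy r) (tidc t) (tidc t′) → V′ (t , vi r) (t′ , vj r)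
      hard-value = proj₁ (proj₂ hard)

      SameObject⊆W : SameObject ⇒ W
      SameObject⊆W (a , (f , f∈ , refl , j , refl , la) , (f′ , f′∈ , refl , j′ , refl , la′) , oa) =
        proj₂ (W≐V′ _ _) (hard-value _
          (∈-translate-sameConstant (Obj⇒objectType f∈ j oa la) (Obj⇒objectType f′∈ j′ oa la′))
          refl (tidOf f) (tidOf f′)
          (sameConstant-Ans f f′ f∈ f′∈ j j′ (≡.trans la (≡.sym la′)) {E′} {V′}
            (λ c cv → IsEquivalenceOn.refl-on (IsEquivalenceOn-resp-≐ isW W≐V′) cv)))

      merge⊆W : merge E V ⇒ W
      merge⊆W (inj₁ v)                    = V⊆W v
      merge⊆W (inj₂ (a , b , va , vb , e)) =
        EqRel-least isW (λ { _ _ (inj₁ w) → w ; _ _ (inj₂ s) → SameObject⊆W s })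
          (proj₂ (proj₂ (E⊆linked e)) va vb)

    V′-characterised : ∀ c d → V′ c d iff (V c d ⊎ VE D E c d)
    V′-characterised c d =
      (λ v′ → W⊆merge (proj₂ (W≐V′ c d) v′)) , (λ u → proj₁ (W≐V′ c d) (merge⊆W u))

    private
      merge≐V′ : merge E V ≐ V′
      merge≐V′ c d = proj₂ (V′-characterised c d) , proj₁ (V′-characterised c d)

      toV′ : ∀ {q} → Sat S D E V q → Sat VS D E′ V′ q
      toV′ {q} sat =
        Sat-valSchema-resp-≐ {E′} {E′} {merge E V} {V′} {q} merge≐V′ (Sat-merge⁺ isE isV {E′} sat)

    hard-object-rules : ∀ r → r ∈ ΓO Sp → ohard r ≡ true → ∀ o o′ →
                        Ans S D E V (obody r) (ox r) (oy r) o o′ → E o o′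
    hard-object-rules r r∈ h o o′ ans =
      let (t , t′ , ↦o , ↦o′ , xt≡yt , sat) =
            ObjectRuleAnswers.Ans-valueRule⁺ r (objectRule-wf r∈) {E′ = E′} isE isV ans
      in merge-objectCells isE isV ↦o ↦o′
           (proj₁ (V′-characterised _ _)
             (hard-value _ (∈-translate-object r∈) h t t′
               (xt≡yt , Sat-valSchema-resp-≐ {E′} {E′} {merge E V} {V′} merge≐V′ sat)))

    hard-value-rules : ∀ r → r ∈ ΓV Sp → vhard r ≡ true → ∀ t t′ →
      Ans S D E V (vbody r) (vx r) (vy r) (tidc t) (tidc t′) → V (t , vi r) (t′ , vj r)
    hard-value-rules r r∈ h t t′ ans@(x≡y , sat) =
      merge-valueCell isE isV (proj₁ (Ans⇒Cells r (valueRule-wf r∈) ans))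
        (proj₁ (V′-characterised _ _) (hard-value r (∈-translate-value r∈) h t t′ (x≡y , toV′ sat)))

    denials : ∀ δ → δ ∈ Δ Sp → ¬ Sat S D E V δ
    denials δ δ∈ sat = proj₂ (proj₂ hard) δ δ∈ (toV′ sat)

    characterised : Characterised E′ V′
    characterised =
      E , V , (E , V , cand , ≐-refl , ≐-refl , hard-object-rules , hard-value-rules , denials)
      , (λ a b e → noObjects-empty (subst (λ R → R a b) (Cand′-noObjects cW) (proj₂ (Ev≐E′ a b) e)))
      , V′-characterised

  IsSol′⇒Characterised : ∀ {E′ V′} → IsSol VS D Sp′ E′ V′ → Characterised E′ V′
  IsSol′⇒Characterised (_ , _ , cW , Ev≐E′ , W≐V′ , hard) =
    characterised cW Ev≐E′ W≐V′ hard (Cand′⇒Reflected cW)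

  FactPosition : Set
  FactPosition = Σ (Fact Sg) (λ f → Fin (arity Sg (rel f)))

  positionsOf : Database Sg → List FactPosition
  positionsOf D′ = List.concatMap (λ f → List.map (f ,_) (List.allFin _)) D′

  ∈-positionsOf⁺ : ∀ {D′ f} → f ∈ D′ → ∀ j → (f , j) ∈ positionsOf D′
  ∈-positionsOf⁺ f∈ j = ∈.∈-concatMap⁺ _ (Any.map (λ { refl → ∈.∈-map⁺ _ (∈.∈-allFin j) }) f∈)

  ∈-positionsOf⁻ : ∀ {D′ p} → p ∈ positionsOf D′ → proj₁ p ∈ D′
  ∈-positionsOf⁻ {D′} p∈ = Any.map (λ m → let (_ , _ , e) = ∈.∈-map⁻ _ m in cong proj₁ e)
                                   (∈.∈-concatMap⁻ _ {D′} p∈)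

  cellOf : FactPosition → Cell
  cellOf (f , j) = tidOf f , suc (toℕ j)

  HoldSameObject : FactPosition → FactPosition → Set
  HoldSameObject (f , j) (f′ , j′) =
    lookup (args f) j ≡ lookup (args f′) j′ × type S (rel f) j ≡ tyO × type S (rel f′) j′ ≡ tyO

  _≟ᶜ_ : (a b : Const) → Dec (a ≡ b)
  obj n  ≟ᶜ obj m  = Dec.map′ (cong obj) (λ { refl → refl }) (n ≟ m)
  val n  ≟ᶜ val m  = Dec.map′ (cong val) (λ { refl → refl }) (n ≟ m)
  tidc n ≟ᶜ tidc m = Dec.map′ (cong tidc) (λ { refl → refl }) (n ≟ m)
  obj _  ≟ᶜ val _  = no λ ()
  obj _  ≟ᶜ tidc _ = no λ ()
  val _  ≟ᶜ obj _  = no λ ()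
  val _  ≟ᶜ tidc _ = no λ ()
  tidc _ ≟ᶜ obj _  = no λ ()
  tidc _ ≟ᶜ val _  = no λ ()

  holdSameObject? : ∀ p p′ → Dec (HoldSameObject p p′)
  holdSameObject? (f , j) (f′ , j′) =
    (lookup (args f) j ≟ᶜ lookup (args f′) j′)
      Dec.×-dec (isObjectPosition? (rel f , j) Dec.×-dec isObjectPosition? (rel f′ , j′))

  initialMerge : Rel₀ Cell
  initialMerge = merge (EqRel emptyRel ObjS) (EqRel emptyRel CellsS)

  initialMerge-isEquivalenceOn : IsEquivalenceOn CellsV initialMerge
  initialMerge-isEquivalenceOn = merge-isEquivalenceOn EqRel-isEquivalenceOn EqRel-isEquivalenceOn

  Saturates : Rel₀ Cell → Rel₀ Cell → (FactPosition → FactPosition → Set) → Set₁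
  Saturates W W′ P = Cand VS D Sp′ noObjects W′ × W′ ⇒ initialMerge × W ⇒ W′
                     × (∀ {p p′} → P p p′ → HoldSameObject p p′ → W′ (cellOf p) (cellOf p′))

  saturate-pair : ∀ {f f′} (j : Fin (arity Sg (rel f))) (j′ : Fin (arity Sg (rel f′))) → f ∈ D → f′ ∈ D →
    ∀ {W} → Cand VS D Sp′ noObjects W → W ⇒ initialMerge →
    ∃[ W′ ] Saturates W W′ (λ p p′ → p ≡ (f , j) × p′ ≡ (f′ , j′))
  saturate-pair {f} {f′} j j′ f∈ f′∈ {W} cW W⊆ with holdSameObject? (f , j) (f′ , j′)
  ... | no ¬same = W , cW , W⊆ , (λ w → w) , λ { (refl , refl) same → ⊥-elim (¬same same) }
  ... | yes (same , ty , ty′) =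
    W′ , stepV cW _ (∈-translate-sameConstant ty ty′) (tidOf f) (tidOf f′) ans
    , EqRel-least initialMerge-isEquivalenceOn step , ⊆-EqRel-∪₂ isW
    , λ { (refl , refl) _ →
            incl (ValAt⇒Cells (ValAt-self f∈ j)) (ValAt⇒Cells (ValAt-self f′∈ j′)) (inj₂ (refl , refl)) }
    where
      isW = Cand′⇒isEquivalenceOn cW
      W′  = EqRel (W ∪₂ single (cellOf (f , j)) (cellOf (f′ , j′))) CellsV
      ans = sameConstant-Ans f f′ f∈ f′∈ j j′ same {noObjects} {W} (λ _ → IsEquivalenceOn.refl-on isW)
      step : ∀ {c d} → CellsV c → CellsV d →
             (W ∪₂ single (cellOf (f , j)) (cellOf (f′ , j′))) c d → initialMerge c d
      step _ _ (inj₁ w)             = W⊆ w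
      step _ _ (inj₂ (refl , refl)) =
        inj₂ (_ , _ , ValAt-self f∈ j , subst (ValAt D _ _) (≡.sym same) (ValAt-self f′∈ j′)
             , refl' (f , f∈ , j , ty , refl))

  saturate : ∀ ps → (∀ {p p′} → (p , p′) ∈ ps → proj₁ p ∈ D × proj₁ p′ ∈ D) →
    ∀ {W} → Cand VS D Sp′ noObjects W → W ⇒ initialMerge →
    ∃[ W′ ] Saturates W W′ (λ p p′ → (p , p′) ∈ ps)
  saturate [] _ {W} cW W⊆ = W , cW , W⊆ , (λ w → w) , λ ()
  saturate (((f , j) , (f′ , j′)) ∷ ps) inD cW W⊆
    with saturate-pair j j′ (proj₁ (inD (here refl))) (proj₂ (inD (here refl))) cW W⊆
  ... | W₁ , cW₁ , W₁⊆ , W⊆W₁ , head with saturate ps (λ m → inD (there m)) cW₁ W₁⊆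
  ... | W′ , cW′ , W′⊆ , W₁⊆W′ , rest =
    W′ , cW′ , W′⊆ , (λ w → W₁⊆W′ (W⊆W₁ w))
    , λ { (here refl) same → W₁⊆W′ (head (refl , refl) same) ; (there m) same → rest m same }

  -- The invariant of the forward simulation: a candidate of Σ′ realises V ∪ V_E.
  record Realised (E : Rel₀ Const) (V : Rel₀ Cell) : Set₁ where
    constructor realised
    field
      {W}     : Rel₀ Cell
      cand    : Cand VS D Sp′ noObjects W
      W≐merge : W ≐ merge E V

  Realised-init : Realised (EqRel emptyRel ObjS) (EqRel emptyRel CellsS)
  Realised-init with saturate (List.cartesianProduct (positionsOf D) (positionsOf D)) inD init emptyRel⊆
    where
      inD : ∀ {p p′} → (p , p′) ∈ List.cartesianProduct (positionsOf D) (positionsOf D) →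
            proj₁ p ∈ D × proj₁ p′ ∈ D
      inD m = let (m₁ , m₂) = ∈.∈-cartesianProduct⁻ (positionsOf D) (positionsOf D) m
              in ∈-positionsOf⁻ m₁ , ∈-positionsOf⁻ m₂
      emptyRel⊆ : EqRel emptyRel CellsV ⇒ initialMerge
      emptyRel⊆ w with EqRel-emptyRel⇒≡ w
      ... | refl = IsEquivalenceOn.refl-on initialMerge-isEquivalenceOn (proj₁ (EqRel-support w))
  ... | W , cW , W⊆ , _ , saturated = realised cW λ c d → W⊆ , merge⊆W
    where
      merge⊆W : initialMerge ⇒ W
      merge⊆W (inj₁ v) with EqRel-emptyRel⇒≡ v
      ... | refl = IsEquivalenceOn.refl-on (Cand′⇒isEquivalenceOn cW) (CellsS⇒CellsV (proj₁ (EqRel-support v)))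
      merge⊆W (inj₂ (_ , _ , (f , f∈ , refl , j , refl , la) , (f′ , f′∈ , refl , j′ , refl , la′) , e))
        with EqRel-emptyRel⇒≡ e
      ... | refl = let oa = proj₁ (EqRel-support e) in
        saturated (∈.∈-cartesianProduct⁺ (∈-positionsOf⁺ f∈ j) (∈-positionsOf⁺ f′∈ j′))
                  (≡.trans la (≡.sym la′) , Obj⇒objectType f∈ j oa la , Obj⇒objectType f′∈ j′ oa la′)

  module _ {E : Rel₀ Const} {V : Rel₀ Cell} (cS : Cand S D Sp E V) (inv : Realised E V) where
    open Realised inv
    private
      isE = proj₁ (Cand⇒isEquivalenceOn cS)
      isV = proj₂ (Cand⇒isEquivalenceOn cS)
      isW = Cand′⇒isEquivalenceOn cand

      W⇒ : W ⇒ merge E V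
      W⇒ = proj₁ (W≐merge _ _)
      ⇒W : merge E V ⇒ W
      ⇒W = proj₂ (W≐merge _ _)

      grow : ∀ {c₁ c₂} → W ⇒ EqRel (W ∪₂ single c₁ c₂) CellsV
      grow = ⊆-EqRel-∪₂ isW

      toW : ∀ {q} → Sat VS D noObjects (merge E V) q → Sat VS D noObjects W q
      toW {q} = Sat-valSchema-resp-≐ {noObjects} {noObjects} {merge E V} {W} {q} (≐-sym W≐merge)

    Realised-stepV : ∀ {r t t′} (r∈ : r ∈ ΓV Sp) → Ans S D E V (vbody r) (vx r) (vy r) (tidc t) (tidc t′) →
                     Realised E (EqRel (V ∪₂ single (t , vi r) (t′ , vj r)) CellsS)
    Realised-stepV {r} {t} {t′} r∈ ans@(x≡y , sat) =
      realised (stepV cand r (∈-translate-value r∈) t t′ (x≡y , toW (Sat-merge⁺ isE isV {noObjects} sat)))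
        λ c d → merge-stepV isE isV W⇒ cs cs′ , from
      where
        cs  = proj₁ (Ans⇒Cells r (valueRule-wf r∈) ans)
        cs′ = proj₂ (Ans⇒Cells r (valueRule-wf r∈) ans)
        from : merge E (EqRel (V ∪₂ single (t , vi r) (t′ , vj r)) CellsS) ⇒
               EqRel (W ∪₂ single (t , vi r) (t′ , vj r)) CellsV
        from (inj₁ v)  = EqRel-stepV (λ v → ⇒W (inj₁ v)) v
        from (inj₂ ve) = grow (⇒W (inj₂ ve))

    Realised-stepO : ∀ {r o o′} (r∈ : r ∈ ΓO Sp) → Ans S D E V (obody r) (ox r) (oy r) o o′ →
                     Realised (EqRel (E ∪₂ single o o′) ObjS) V
    Realised-stepO {r} {o} {o′} r∈ ans =
      realise (ObjectRuleAnswers.Ans-valueRule⁺ r (objectRule-wf r∈) {E′ = noObjects} isE isV ans)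
      where
        open ObjectRule r (objectRule-wf r∈) using (pa; pb; q⁺; xt; yt)
        realise : ∃[ t ] ∃[ t′ ] ((t , pa) ↦[ E ] o × (t′ , pb) ↦[ E ] o′
                                  × Ans VS D noObjects (merge E V) q⁺ xt yt (tidc t) (tidc t′)) →
                  Realised (EqRel (E ∪₂ single o o′) ObjS) V
        realise (t , t′ , ↦o@(_ , va₁ , _) , ↦o′@(_ , va₂ , _) , (xt≡yt , sat)) =
          realised (stepV cand (translatedRule r∈) (∈-translate-object r∈) t t′ (xt≡yt , toW sat))
            λ c d → merge-stepO isE isV W⇒ ↦o ↦o′ , from
          where
            W′ : Rel₀ Cell
            W′ = EqRel (W ∪₂ single (t , pa) (t′ , pb)) CellsV
            linked : EqRel (E ∪₂ single o o′) ObjS ⇒ Linked W′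
            linked = Linked-stepO isE isV EqRel-isEquivalenceOn
              (λ (a , vc , vd , oa) → grow (⇒W (inj₂ (a , a , vc , vd , IsEquivalenceOn.refl-on isE oa))))
              (λ {a} {b} e → proj₁ (IsEquivalenceOn.support isE e) , proj₂ (IsEquivalenceOn.support isE e)
                            , λ vc vd → grow (⇒W (inj₂ (a , b , vc , vd , e))))
              ↦o ↦o′ (incl (ValAt⇒Cells va₁) (ValAt⇒Cells va₂) (inj₂ (refl , refl)))
            from : merge (EqRel (E ∪₂ single o o′) ObjS) V ⇒ W′
            from (inj₁ v)                    = grow (⇒W (inj₁ v))
            from (inj₂ (a , b , va , vb , e)) = proj₂ (proj₂ (linked e)) va vb

  Cand⇒Realised : ∀ {E V} → Cand S D Sp E V → Realised E V
  Cand⇒Realised init                      = Realised-init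
  Cand⇒Realised (stepO cS r r∈ o o′ ans) = Realised-stepO cS (Cand⇒Realised cS) r∈ ans
  Cand⇒Realised (stepV cS r r∈ t t′ ans) = Realised-stepV cS (Cand⇒Realised cS) r∈ ans

  Characterised⇒IsSol′ : ∀ {E′ V′} → Characterised E′ V′ → IsSol VS D Sp′ E′ V′
  Characterised⇒IsSol′ {E′} {V′} (E , V , (E₀ , V₀ , cS , E₀≐E , V₀≐V , hardS) , ¬E′ , V′≐) =
    noObjects , W , cand , noObjects≐E′ , W≐V′ , (λ _ ()) , hard-values , denials′
    where
      isE = IsEquivalenceOn-resp-≐ (proj₁ (Cand⇒isEquivalenceOn cS)) E₀≐E
      isV = IsEquivalenceOn-resp-≐ (proj₂ (Cand⇒isEquivalenceOn cS)) V₀≐V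

      open Realised (Cand⇒Realised cS)

      noObjects≐E′ : noObjects ≐ E′
      noObjects≐E′ a b = (λ e → ⊥-elim (noObjects-empty e)) , (λ e → ⊥-elim (¬E′ a b e))

      V′⇒ : V′ ⇒ merge E V
      V′⇒ = proj₁ (V′≐ _ _)
      ⇒V′ : merge E V ⇒ V′
      ⇒V′ = proj₂ (V′≐ _ _)

      W≐V′ : W ≐ V′
      W≐V′ c d = (λ w → ⇒V′ (merge-resp-≐ E₀≐E V₀≐V (proj₁ (W≐merge c d) w)))
               , (λ v → proj₂ (W≐merge c d) (merge-resp-≐ (≐-sym E₀≐E) (≐-sym V₀≐V) (V′⇒ v)))

      hard-values : ∀ r → r ∈ ΓV Sp′ → vhard r ≡ true → ∀ t t′ →
        Ans VS D E′ V′ (vbody r) (vx r) (vy r) (tidc t) (tidc t′) → V′ (t , vi r) (t′ , vj r)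
      hard-values r r∈ h t t′ ans with ruleOrigin r∈
      ... | value r∈V =
        ⇒V′ (inj₁ (proj₁ (proj₂ hardS) r r∈V h t t′
                     (Ans-merge⁻ isE isV {E′} {V′} {vbody r} V′⇒ (proj₁ (valueRule-wf r∈V)) ans)))
      ... | object {r₀} r₀∈ =
        let (o , o′ , ansS , (a₁ , va₁ , e₁) , (a₂ , va₂ , e₂)) =
              ObjectRuleAnswers.Ans-valueRule⁻ r₀ (objectRule-wf r₀∈) {E} {V} {E′} {V′} isE isV V′⇒ ans
        in ⇒V′ (inj₂ (a₁ , a₂ , va₁ , va₂
                     , E.trans e₁ (E.trans (proj₁ hardS r₀ r₀∈ h o o′ ansS) (E.sym e₂))))
        where module E = IsEquivalenceOn isE
      hard-values r r∈ h t t′ ans | sameConstant {R} {i} {R′} {i′} ty ty′ =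
        let (_ , reach , reach′) = Ans-sameConstant⁻ R i R′ i′ {E′} {V′} ans
        in ⇒V′ (inj₂ (sameConstant-VE isE isV V′⇒ ty ty′ reach reach′))

      denials′ : ∀ δ → δ ∈ Δ Sp → ¬ Sat VS D E′ V′ δ
      denials′ δ δ∈ sat =
        proj₂ (proj₂ hardS) δ δ∈
          (Sat-merge⁻ isE isV {E′} (Sat-valSchema-resp-≐ {E′} {E′} {V′} {merge E V} V′≐ sat))

theorem1 : (Sim : Set) (sem : Sim → Const → Const → Set) →
    let open ER Sim sem in
    (S : Schema) (Sp : Spec (sig S)) → WFSpec S Sp →
    ∃[ Sp' ] (WFSpec (valSchema S) Sp' × ΓO Sp' ≡ [] × Δ Sp' ≡ Δ Sp ×
      ((D : Database (sig S)) → WellTyped S D → UniqueTids D →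
        (E' : Rel₀ Const) (V' : Rel₀ Cell) →
        IsSol (valSchema S) D Sp' E' V' iff
          (∃[ E ] ∃[ V ] (IsSol S D Sp E V × (∀ a b → ¬ E' a b)
                          × (∀ c d → V' c d iff (V c d ⊎ VE D E c d))))))
theorem1 Sim sem S Sp wf =
  translate , translate-wf , refl , refl ,
  λ D wt ut E′ V′ → let open Simulation Sim sem S Sp wf D wt ut
                    in IsSol′⇒Characterised , Characterised⇒IsSol′
  where open Translation.Translated Sim sem S Sp wf using (translate; translate-wf)
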